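{- Up to isomorphism of signed graphs, there are exactly five connected strongly regular signed graphs that are $5$-regular and $3$ net-regular, namely: (i) $\dot G_1$: the complete graph $K_6$ in which the negative edges form a perfect matching and all other edges are positive (parameters $(n,r,a,b)=(6,5,0,4)$); (ii) $\dot S^1_8$: the signed graph with vertex set $\{(i,s): i\in\mathbb{Z}_4,\ s\in\{0,1\}\}$, where $(i,0)(i,1)$ is a negative edge for each $i$, and $(i,s)(i\pm 1,t)$ is a positive edge for all $i$ and all $s,t\in\{0,1\}$, with no other edges (parameters $(8,5,-2,4,4)$); (iii) $\dot S^1_{10}$: the signed graph defined in the same way as in (ii) but with $\mathbb{Z}_5$ in place of $\mathbb{Z}_4$ (parameters $(10,5,-2,4,2)$); (iv) $\dot S^2_{10}$: the complete bipartite graph $K_{5,5}$ in which the negative edges form a perfect matching and all other edges are positive (parameters $(10,5,0,0,1)$); (v) $\dot S^3_{10}$: two disjoint copies of $K_5$ with all their edges positive, together with a perfect matching of negative edges joining the vertices of the first copy to the vertices of the second copy (parameters $(10,5,3,0,-2)$).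
   Context: A signed graph $\dot G=(G,\sigma)$ is a simple graph $G$ (its underlying graph) with a sign function $\sigma:E(G)\to\{+1,-1\}$. Its adjacency matrix $A_{\dot G}=(a_{ij})$ has $a_{ij}=\sigma(v_iv_j)$ if $v_i\sim v_j$ and $0$ otherwise. The degree of a vertex is its degree in $G$; $d^+(v)$ and $d^-(v)$ are the numbers of positive and negative edges at $v$; the net-degree of $v$ is $d^+(v)-d^-(v)$, and $\dot G$ is $\rho$ net-regular if every vertex has net-degree $\rho$. Connectedness and completeness refer to the underlying graph. $\dot G$ is homogeneous if all its edges have the same sign. A signed graph $\dot G$ on $n$ vertices is strongly regular (an SRSG) if it is neither homogeneous complete nor edgeless and there exist $r\in\mathbb{N}$ and $a,b,c\in\mathbb{Z}$ such that the entries of $A_{\dot G}^2$ satisfy: $(A^2_{\dot G})_{ii}=r$; $(A^2_{\dot G})_{ij}=a$ if $v_iv_j$ is a positive edge; $=b$ if $v_iv_j$ is a negative edge; $=c$ if $v_i\neq v_j$ are non-adjacent. Its parameters are written $(n,r,a,b,c)$, or $(n,r,a,b)$ if $\dot G$ is complete. Two signed graphs are isomorphic if there is an isomorphism of underlying graphs preserving edge signs. -}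

module Defs where

open import Data.Nat using (ℕ; zero; suc; _+_; _/_; _%_; _≡ᵇ_; _<ᵇ_; NonZero)
open import Data.Bool using (Bool; true; false; if_then_else_; _∨_; _∧_; not)
open import Data.Integer using (ℤ; +_; -_; _-_) renaming (_+_ to _+ℤ_; _*_ to _*ℤ_)
open import Data.Fin using (Fin; toℕ) renaming (zero to fzero; suc to fsuc)
open import Data.Product using (Σ; _×_; ∃-syntax)
open import Data.Sum using (_⊎_)
open import Relation.Binary.PropositionalEquality using (_≡_)
open import Relation.Nullary using (¬_)
open import Function.Bundles using (_↔_; Inverse)

-- Signed graphs on the vertex set Fin n.
-- σ i j = pos / neg : i ~ j with that sign;  σ i j = non : not adjacent.

data Sign : Set where
  pos neg non : Sign

IsSimple : ∀ {n} → (Fin n → Fin n → Sign) → Set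
IsSimple {n} σ = (∀ i j → σ i j ≡ σ j i) × (∀ i → σ i i ≡ non)

isPos isNeg isAdj : Sign → Bool
isPos pos = true
isPos _   = false
isNeg neg = true
isNeg _   = false
isAdj non = false
isAdj _   = true

entry : Sign → ℤ
entry pos = + 1
entry neg = - (+ 1)
entry non = + 0

count : ∀ {n} → (Fin n → Bool) → ℕ
count {zero}  p = 0
count {suc n} p = (if p fzero then 1 else 0) + count (λ i → p (fsuc i))

sumℤ : ∀ {n} → (Fin n → ℤ) → ℤ
sumℤ {zero}  f = + 0
sumℤ {suc n} f = f fzero +ℤ sumℤ (λ i → f (fsuc i))

module _ {n : ℕ} (σ : Fin n → Fin n → Sign) where

  deg : Fin n → ℕ
  deg i = count (λ j → isAdj (σ i j))

  dplus dminus : Fin n → ℕ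
  dplus  i = count (λ j → isPos (σ i j))
  dminus i = count (λ j → isNeg (σ i j))

  netdeg : Fin n → ℤ
  netdeg i = + dplus i - + dminus i

  Regular : ℕ → Set
  Regular r = ∀ i → deg i ≡ r

  NetRegular : ℤ → Set
  NetRegular ρ = ∀ i → netdeg i ≡ ρ

  sq : Fin n → Fin n → ℤ
  sq i j = sumℤ (λ k → entry (σ i k) *ℤ entry (σ k j))

  data Reach : Fin n → Fin n → Set where
    here : ∀ {i} → Reach i i
    step : ∀ {i j k} → isAdj (σ i j) ≡ true → Reach j k → Reach i k

  Connected : Set
  Connected = ∀ i j → Reach i j

  Complete : Set
  Complete = ∀ i j → ¬ (i ≡ j) → ¬ (σ i j ≡ non)

  Homogeneous : Set
  Homogeneous = (∀ i j → ¬ (σ i j ≡ neg)) ⊎ (∀ i j → ¬ (σ i j ≡ pos))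

  Edgeless : Set
  Edgeless = ∀ i j → σ i j ≡ non

  -- strongly regular with parameters (n, r, a, b, c)
  -- (for complete graphs the condition on c is vacuous)
  SRSGParams : ℕ → ℤ → ℤ → ℤ → Set
  SRSGParams r a b c =
    ¬ (Homogeneous × Complete) × ¬ Edgeless ×
    (∀ i → sq i i ≡ + r) ×
    (∀ i j → σ i j ≡ pos → sq i j ≡ a) ×
    (∀ i j → σ i j ≡ neg → sq i j ≡ b) ×
    (∀ i j → ¬ (i ≡ j) → σ i j ≡ non → sq i j ≡ c)

  IsSRSG : Set
  IsSRSG = Σ ℕ λ r → Σ ℤ λ a → Σ ℤ λ b → Σ ℤ λ c → SRSGParams r a b c

Iso : ∀ {n m} → (Fin n → Fin n → Sign) → (Fin m → Fin m → Sign) → Set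
Iso {n} {m} σ τ = Σ (Fin n ↔ Fin m) λ f →
  ∀ i j → τ (Inverse.to f i) (Inverse.to f j) ≡ σ i j

-- (i) K6 with negative perfect matching {0,1},{2,3},{4,5}
G1 : Fin 6 → Fin 6 → Sign
G1 u v = if toℕ u ≡ᵇ toℕ v then non
         else if (toℕ u / 2) ≡ᵇ (toℕ v / 2) then neg else pos

-- (ii),(iii) vertex (i,s), i ∈ ℤ_k, s ∈ {0,1}, encoded as 2i+s
S1 : (k : ℕ) .{{_ : NonZero k}} → Fin (k + k) → Fin (k + k) → Sign
S1 k u v =
  let i = toℕ u / 2 ; j = toℕ v / 2 in
  if toℕ u ≡ᵇ toℕ v then non
  else if i ≡ᵇ j then neg
  else if ((suc i % k) ≡ᵇ j) ∨ ((suc j % k) ≡ᵇ i) then pos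
  else non

S18 : Fin 8 → Fin 8 → Sign
S18 = S1 4

S110 : Fin 10 → Fin 10 → Sign
S110 = S1 5

-- parts {0..4} and {5..9}; u and u+5 are "matched"
part : Fin 10 → Bool
part u = toℕ u <ᵇ 5

matched : Fin 10 → Fin 10 → Bool
matched u v = not (part u ≡ᵇB part v) ∧ (toℕ u % 5 ≡ᵇ toℕ v % 5)
  where
  _≡ᵇB_ : Bool → Bool → Bool
  true  ≡ᵇB b = b
  false ≡ᵇB b = not b

-- (iv) K_{5,5} with negative perfect matching
S210 : Fin 10 → Fin 10 → Sign
S210 u v = if matched u v then neg
           else if part u ≡ᵇ' part v then non else pos
  where
  _≡ᵇ'_ : Bool → Bool → Bool
  true  ≡ᵇ' b = b
  false ≡ᵇ' b = not b

-- (v) two positive K5's joined by a negative perfect matching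
S310 : Fin 10 → Fin 10 → Sign
S310 u v = if toℕ u ≡ᵇ toℕ v then non
           else if matched u v then neg
           else if part u ≡ᵇ' part v then pos else non
  where
  _≡ᵇ'_ : Bool → Bool → Bool
  true  ≡ᵇ' b = b
  false ≡ᵇ' b = not b

order : Fin 5 → ℕ
order fzero = 6
order (fsuc fzero) = 8
order (fsuc (fsuc _)) = 10

cand : (p : Fin 5) → Fin (order p) → Fin (order p) → Sign
cand fzero = G1
cand (fsuc fzero) = S18
cand (fsuc (fsuc fzero)) = S110
cand (fsuc (fsuc (fsuc fzero))) = S210
cand (fsuc (fsuc (fsuc (fsuc fzero)))) = S310

Good : ∀ {n} → (Fin n → Fin n → Sign) → Set
Good σ = IsSimple σ × Connected σ × Regular σ 5 × NetRegular σ (+ 3) × IsSRSG σ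

-- In a 5-regular signed graph of net-degree 3 every vertex has four positive neighbours and
-- one negative one.  A connected such graph is therefore rebuilt from any vertex by closing
-- vertices in order of discovery: the first open vertex gets a sign (or none) towards each
-- other open vertex already discovered, and its missing neighbours are new vertices.  Strong
-- regularity prunes this search, since the product of a row of A with a completed row is an
-- entry of A² and must equal the parameter a, b or c of its sign, each learnt when first met.
-- The search is finite and is run by evaluation; every surviving branch comes with a
-- certified isomorphism to one of the five graphs, and an invariant relating search states to
-- injective partial labellings of a given graph makes the search sound.  The five graphs are
-- checked directly, and are told apart by their order and by which of the signed triangles
-- (+,+,+) and (−,+,+) they contain.

module Submission where

open import Defs
open import Data.Nat using (ℕ)
open import Data.Integer using (+_; -_)
open import Data.Fin using (Fin) renaming (zero to fzero; suc to fsuc)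
open import Data.Product using (_×_; ∃-syntax)
open import Relation.Binary.PropositionalEquality using (_≡_)

open import Algebra.Properties.CommutativeSemigroup using (interchange)
open import Data.Bool using (Bool; true; false; if_then_else_; _∧_; _∨_; not; T)
import Data.Bool as Bool
open import Data.Bool.Properties using (T-∧; T-∨; T-≡; ∧-zeroʳ; ∧-identityʳ)
open import Data.Empty using (⊥-elim)
open import Data.Fin using (#_)
import Data.Fin as Fin
open import Data.Fin.Permutation using (↔⇒≡)
import Data.Fin.Properties as FinP
open import Data.Integer using (ℤ) renaming (_+_ to _+ℤ_; _*_ to _*ℤ_; _-_ to _-ℤ_)
import Data.Integer as ℤ
import Data.Integer.Properties as ℤP
open import Data.List using (List; []; _∷_; _++_; length; replicate; map; filterᵇ; upTo; allFin)
open import Data.List.Membership.Propositional using (_∈_; _∉_)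
open import Data.List.Membership.Propositional.Properties
  using (∈-map⁺; ∈-map⁻; ∈-++⁺ˡ; ∈-++⁺ʳ; ∈-++⁻; ∈-filter⁻; ∈-filter⁺; ∈-upTo⁺; ∈-upTo⁻)
open import Data.List.Properties using (length-++; length-replicate; length-map; map-++)
import Data.List.Relation.Unary.All as All
open import Data.List.Relation.Unary.AllPairs using ([]; _∷_)
import Data.List.Relation.Unary.AllPairs as AllPairs
open import Data.List.Relation.Unary.Any using (here; there)
open import Data.List.Relation.Unary.Unique.Propositional using (Unique)
import Data.List.Relation.Unary.Unique.Propositional.Properties as UniqueP
open import Data.Maybe using (Maybe; just; nothing; _<∣>_; is-just; is-nothing)
import Data.Maybe as Maybe
open import Data.Maybe.Properties using (just-injective)
open import Data.Nat using (zero; suc; _+_; _∸_; _≤_; _<_; z≤n; s≤s; _≡ᵇ_; _<ᵇ_)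
import Data.Nat.Properties as ℕP
open import Data.List.Membership.DecPropositional ℕP._≟_ using (_∈?_)
open import Data.Product using (_,_; proj₁; proj₂)
open import Data.Product.Properties using (≡-dec)
open import Data.Sum using (_⊎_; inj₁; inj₂)
open import Data.Unit using (tt)
open import Function using (_∘_; id; case_of_; mk⇔)
open import Function.Bundles using (Inverse; Equivalence; mk↔ₛ′)
open import Function.Construct.Symmetry using (↔-sym)
open import Relation.Binary.Definitions using (DecidableEquality)
open import Relation.Binary.PropositionalEquality using (refl; sym; trans; cong; cong₂; subst; _≢_; module ≡-Reasoning)
open import Relation.Nullary using (¬_; Dec; yes; no; does)
open import Relation.Nullary.Decidable
  using (True; T?; toWitness; dec-true; dec-false; does-⇔; ¬?; _×-dec_; _⊎-dec_; _→-dec_)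

sumTo : ℕ → (ℕ → ℤ) → ℤ
sumTo zero    f = + 0
sumTo (suc m) f = f 0 +ℤ sumTo m (f ∘ suc)

countTo : ℕ → (ℕ → Bool) → ℕ
countTo zero    p = 0
countTo (suc m) p = (if p 0 then 1 else 0) + countTo m (p ∘ suc)

sumTo-cong : ∀ m {f g : ℕ → ℤ} → (∀ k → k < m → f k ≡ g k) → sumTo m f ≡ sumTo m g
sumTo-cong zero    eq = refl
sumTo-cong (suc m) eq = cong₂ _+ℤ_ (eq 0 (s≤s z≤n)) (sumTo-cong m (λ k k<m → eq (suc k) (s≤s k<m)))

sumTo-zero : ∀ m {f : ℕ → ℤ} → (∀ k → f k ≡ + 0) → sumTo m f ≡ + 0
sumTo-zero zero    eq = refl
sumTo-zero (suc m) eq = cong₂ _+ℤ_ (eq 0) (sumTo-zero m (eq ∘ suc))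

countTo-cong : ∀ m {p q : ℕ → Bool} → (∀ k → k < m → p k ≡ q k) → countTo m p ≡ countTo m q
countTo-cong zero    eq = refl
countTo-cong (suc m) eq =
  cong₂ (λ b c → (if b then 1 else 0) + c) (eq 0 (s≤s z≤n)) (countTo-cong m (λ k k<m → eq (suc k) (s≤s k<m)))

countTo-zero : ∀ m {p : ℕ → Bool} → (∀ k → p k ≡ false) → countTo m p ≡ 0
countTo-zero zero    eq = refl
countTo-zero (suc m) eq rewrite eq 0 = countTo-zero m (eq ∘ suc)

countTo-mono : ∀ m {p q : ℕ → Bool} → (∀ k → k < m → T (p k) → T (q k)) → countTo m p ≤ countTo m q
countTo-mono zero    imp = z≤n
countTo-mono (suc m) {p} {q} imp with p 0 | q 0 | imp 0 (s≤s z≤n)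
... | true  | true  | _  = s≤s (countTo-mono m (λ k k<m → imp (suc k) (s≤s k<m)))
... | true  | false | pq = ⊥-elim (pq tt)
... | false | true  | _  = ℕP.m≤n⇒m≤1+n (countTo-mono m (λ k k<m → imp (suc k) (s≤s k<m)))
... | false | false | _  = countTo-mono m (λ k k<m → imp (suc k) (s≤s k<m))

sumℤ-cong : ∀ {n} {f g : Fin n → ℤ} → (∀ j → f j ≡ g j) → sumℤ f ≡ sumℤ g
sumℤ-cong {zero}  eq = refl
sumℤ-cong {suc n} eq = cong₂ _+ℤ_ (eq fzero) (sumℤ-cong (eq ∘ fsuc))

sumℤ-zero : ∀ {n} {f : Fin n → ℤ} → (∀ j → f j ≡ + 0) → sumℤ f ≡ + 0
sumℤ-zero {zero}  eq = refl
sumℤ-zero {suc n} eq = cong₂ _+ℤ_ (eq fzero) (sumℤ-zero (eq ∘ fsuc))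

sumℤ-+ : ∀ {n} (f g : Fin n → ℤ) → sumℤ (λ j → f j +ℤ g j) ≡ sumℤ f +ℤ sumℤ g
sumℤ-+ {zero}  f g = refl
sumℤ-+ {suc n} f g =
  trans (cong (f fzero +ℤ g fzero +ℤ_) (sumℤ-+ (f ∘ fsuc) (g ∘ fsuc)))
        (interchange ℤP.+-commutativeSemigroup (f fzero) (g fzero) _ _)

sumℤ-single : ∀ {n} (i : Fin n) (v : ℤ) → sumℤ (λ j → if does (i Fin.≟ j) then v else + 0) ≡ v
sumℤ-single {suc n} fzero    v = trans (cong (v +ℤ_) (sumℤ-zero {n} (λ _ → refl))) (ℤP.+-identityʳ v)
sumℤ-single {suc n} (fsuc i) v = trans (ℤP.+-identityˡ _) (sumℤ-single i v)

InjectiveBelow : ∀ {n} → ℕ → (ℕ → Fin n) → Set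
InjectiveBelow m ρ = ∀ {k l} → k < m → l < m → ρ k ≡ ρ l → k ≡ l

OutsideImage : ∀ {n} → ℕ → (ℕ → Fin n) → Fin n → Set
OutsideImage m ρ j = ∀ k → k < m → ρ k ≢ j

InjectiveBelow-suc : ∀ {n m} {ρ : ℕ → Fin n} → InjectiveBelow (suc m) ρ → InjectiveBelow m (ρ ∘ suc)
InjectiveBelow-suc inj k<m l<m eq = ℕP.suc-injective (inj (s≤s k<m) (s≤s l<m) eq)

sumℤ-reindex : ∀ {n} m (ρ : ℕ → Fin n) (f : Fin n → ℤ) → InjectiveBelow m ρ →
               (∀ j → OutsideImage m ρ j → f j ≡ + 0) → sumℤ f ≡ sumTo m (f ∘ ρ)
sumℤ-reindex zero    ρ f inj vanish = sumℤ-zero (λ j → vanish j (λ _ ()))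
sumℤ-reindex {n} (suc m) ρ f inj vanish = begin
  sumℤ f                                  ≡⟨ sumℤ-cong split ⟩
  sumℤ (λ j → at₀ j +ℤ rest j)             ≡⟨ sumℤ-+ at₀ rest ⟩
  sumℤ at₀ +ℤ sumℤ rest                    ≡⟨ cong₂ _+ℤ_ (sumℤ-single (ρ 0) (f (ρ 0))) rest-reindexed ⟩
  f (ρ 0) +ℤ sumTo m (rest ∘ ρ ∘ suc)      ≡⟨ cong (f (ρ 0) +ℤ_) (sumTo-cong m rest-agrees) ⟩
  f (ρ 0) +ℤ sumTo m (f ∘ ρ ∘ suc)         ∎
  where
  open ≡-Reasoning
  at₀ rest : Fin n → ℤ
  at₀  j = if does (ρ 0 Fin.≟ j) then f (ρ 0) else + 0
  rest j = if does (ρ 0 Fin.≟ j) then + 0 else f j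

  split : ∀ j → f j ≡ at₀ j +ℤ rest j
  split j with ρ 0 Fin.≟ j
  ... | yes refl = sym (ℤP.+-identityʳ (f (ρ 0)))
  ... | no  _    = sym (ℤP.+-identityˡ (f j))

  rest-vanish : ∀ j → OutsideImage m (ρ ∘ suc) j → rest j ≡ + 0
  rest-vanish j outside with ρ 0 Fin.≟ j
  ... | yes _  = refl
  ... | no  ≢j = vanish j λ { zero _ → ≢j ; (suc k) (s≤s k<m) → outside k k<m }

  rest-reindexed : sumℤ rest ≡ sumTo m (rest ∘ ρ ∘ suc)
  rest-reindexed = sumℤ-reindex m (ρ ∘ suc) rest (InjectiveBelow-suc inj) rest-vanish

  rest-agrees : ∀ k → k < m → rest (ρ (suc k)) ≡ f (ρ (suc k))
  rest-agrees k k<m with ρ 0 Fin.≟ ρ (suc k)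
  ... | yes eq = ⊥-elim (ℕP.0≢1+n (inj (s≤s z≤n) (s≤s k<m) eq))
  ... | no  _  = refl

indicator : Bool → ℤ
indicator b = if b then + 1 else + 0

pos-indicator : ∀ b → + (if b then 1 else 0) ≡ indicator b
pos-indicator true  = refl
pos-indicator false = refl

count-sumℤ : ∀ {n} (p : Fin n → Bool) → + count p ≡ sumℤ (indicator ∘ p)
count-sumℤ {zero}  p = refl
count-sumℤ {suc n} p =
  trans (ℤP.pos-+ (if p fzero then 1 else 0) _) (cong₂ _+ℤ_ (pos-indicator (p fzero)) (count-sumℤ (p ∘ fsuc)))

countTo-sumTo : ∀ m (p : ℕ → Bool) → + countTo m p ≡ sumTo m (indicator ∘ p)
countTo-sumTo zero    p = refl
countTo-sumTo (suc m) p =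
  trans (ℤP.pos-+ (if p 0 then 1 else 0) _) (cong₂ _+ℤ_ (pos-indicator (p 0)) (countTo-sumTo m (p ∘ suc)))

count-reindex : ∀ {n} m (ρ : ℕ → Fin n) (p : Fin n → Bool) → InjectiveBelow m ρ →
                (∀ j → OutsideImage m ρ j → p j ≡ false) → count p ≡ countTo m (p ∘ ρ)
count-reindex m ρ p inj vanish = ℤP.+-injective (begin
  + count p                       ≡⟨ count-sumℤ p ⟩
  sumℤ (indicator ∘ p)            ≡⟨ sumℤ-reindex m ρ (indicator ∘ p) inj (λ j out → cong indicator (vanish j out)) ⟩
  sumTo m (indicator ∘ p ∘ ρ)     ≡⟨ countTo-sumTo m (p ∘ ρ) ⟨
  + countTo m (p ∘ ρ)             ∎)
  where open ≡-Reasoning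

count-split : ∀ {n} (p q : Fin n → Bool) → count p ≡ count (λ j → p j ∧ q j) + count (λ j → p j ∧ not (q j))
count-split {zero}  p q = refl
count-split {suc n} p q with p fzero | q fzero | count-split (p ∘ fsuc) (q ∘ fsuc)
... | true  | true  | eq = cong suc eq
... | true  | false | eq = trans (cong suc eq) (sym (ℕP.+-suc _ _))
... | false | true  | eq = eq
... | false | false | eq = eq

split< : ∀ m l {k} → k < m + l → k < m ⊎ ∃[ t ] k ≡ m + t × t < l
split< zero    l {k}     k<l       = inj₂ (k , refl , k<l)
split< (suc m) l {zero}  _         = inj₁ (s≤s z≤n)
split< (suc m) l {suc k} (s≤s k<) with split< m l k<
... | inj₁ k<m           = inj₁ (s≤s k<m)
... | inj₂ (t , refl , t<l) = inj₂ (t , refl , t<l)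

nthOr : ∀ {A : Set} → A → List A → ℕ → A
nthOr d []       _       = d
nthOr d (a ∷ _)  zero    = a
nthOr d (_ ∷ as) (suc k) = nthOr d as k

setAt : ∀ {A : Set} → List A → ℕ → A → List A
setAt []       _       _ = []
setAt (_ ∷ as) zero    b = b ∷ as
setAt (a ∷ as) (suc k) b = a ∷ setAt as k b

module _ {A : Set} where

  nthOr-++ˡ : ∀ (d : A) xs ys {k} → k < length xs → nthOr d (xs ++ ys) k ≡ nthOr d xs k
  nthOr-++ˡ d (x ∷ xs) ys {zero}  _         = refl
  nthOr-++ˡ d (x ∷ xs) ys {suc k} (s≤s k<n) = nthOr-++ˡ d xs ys k<n

  nthOr-++ʳ : ∀ (d : A) xs ys k → nthOr d (xs ++ ys) (length xs + k) ≡ nthOr d ys k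
  nthOr-++ʳ d []       ys k = refl
  nthOr-++ʳ d (x ∷ xs) ys k = nthOr-++ʳ d xs ys k

  nthOr-beyond : ∀ (d : A) xs {k} → length xs ≤ k → nthOr d xs k ≡ d
  nthOr-beyond d []       _         = refl
  nthOr-beyond d (x ∷ xs) (s≤s n≤k) = nthOr-beyond d xs n≤k

  nthOr-map : ∀ {B : Set} (f : A → B) (d : A) (d′ : B) xs {k} → k < length xs →
              nthOr d′ (map f xs) k ≡ f (nthOr d xs k)
  nthOr-map f d d′ (x ∷ xs) {zero}  _         = refl
  nthOr-map f d d′ (x ∷ xs) {suc k} (s≤s k<n) = nthOr-map f d d′ xs k<n

  length-setAt : ∀ (xs : List A) k b → length (setAt xs k b) ≡ length xs
  length-setAt []       k       b = refl
  length-setAt (x ∷ xs) zero    b = refl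
  length-setAt (x ∷ xs) (suc k) b = cong suc (length-setAt xs k b)

  nthOr-setAt-here : ∀ (d : A) xs {k} b → k < length xs → nthOr d (setAt xs k b) k ≡ b
  nthOr-setAt-here d (x ∷ xs) {zero}  b _         = refl
  nthOr-setAt-here d (x ∷ xs) {suc k} b (s≤s k<n) = nthOr-setAt-here d xs b k<n

  nthOr-setAt-there : ∀ (d : A) xs {k l} b → l ≢ k → nthOr d (setAt xs k b) l ≡ nthOr d xs l
  nthOr-setAt-there d []       {k}     {l}     b l≢k = refl
  nthOr-setAt-there d (x ∷ xs) {zero}  {zero}  b l≢k = ⊥-elim (l≢k refl)
  nthOr-setAt-there d (x ∷ xs) {zero}  {suc l} b l≢k = refl
  nthOr-setAt-there d (x ∷ xs) {suc k} {zero}  b l≢k = refl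
  nthOr-setAt-there d (x ∷ xs) {suc k} {suc l} b l≢k = nthOr-setAt-there d xs b (l≢k ∘ cong suc)

  nthOr-∈ : ∀ (d : A) xs {k} → k < length xs → nthOr d xs k ∈ xs
  nthOr-∈ d (x ∷ xs) {zero}  _         = here refl
  nthOr-∈ d (x ∷ xs) {suc k} (s≤s k<n) = there (nthOr-∈ d xs k<n)

  ∈⇒nthOr : ∀ (d : A) {xs x} → x ∈ xs → ∃[ k ] k < length xs × nthOr d xs k ≡ x
  ∈⇒nthOr d (here refl) = 0 , s≤s z≤n , refl
  ∈⇒nthOr d (there x∈xs) with ∈⇒nthOr d x∈xs
  ... | k , k<n , eq = suc k , s≤s k<n , eq

  nthOr-injective : ∀ (d : A) {xs} → Unique xs → ∀ {k l} → k < length xs → l < length xs →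
                    nthOr d xs k ≡ nthOr d xs l → k ≡ l
  nthOr-injective d {x ∷ xs} (x∉ ∷ uniq) {zero}  {zero}  _ _ _ = refl
  nthOr-injective d {x ∷ xs} (x∉ ∷ uniq) {zero}  {suc l} _ (s≤s l<n) eq =
    ⊥-elim (All.lookup x∉ (nthOr-∈ d xs l<n) eq)
  nthOr-injective d {x ∷ xs} (x∉ ∷ uniq) {suc k} {zero}  (s≤s k<n) _ eq =
    ⊥-elim (All.lookup x∉ (nthOr-∈ d xs k<n) (sym eq))
  nthOr-injective d {x ∷ xs} (x∉ ∷ uniq) {suc k} {suc l} (s≤s k<n) (s≤s l<n) eq =
    cong suc (nthOr-injective d uniq k<n l<n eq)

  ∉-∷ : ∀ {k u : A} {us} → k ≢ u → k ∉ us → k ∉ u ∷ us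
  ∉-∷ k≢u k∉ (here k≡u) = k≢u k≡u
  ∉-∷ k≢u k∉ (there k∈) = k∉ k∈

  nthOr-replicate : ∀ (d : A) l k → nthOr d (replicate l d) k ≡ d
  nthOr-replicate d zero    k       = refl
  nthOr-replicate d (suc l) zero    = refl
  nthOr-replicate d (suc l) (suc k) = nthOr-replicate d l k

  map-const-on : ∀ {B : Set} (f : A → B) {c} xs → (∀ {a} → a ∈ xs → f a ≡ c) → map f xs ≡ replicate (length xs) c
  map-const-on f []       const = refl
  map-const-on f (x ∷ xs) const = cong₂ _∷_ (const (here refl)) (map-const-on f xs (const ∘ there))

enumerate : ∀ {n} → (Fin n → Bool) → List (Fin n)
enumerate {zero}  p = []
enumerate {suc n} p = (if p fzero then fzero ∷_ else id) (map fsuc (enumerate (p ∘ fsuc)))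

length-enumerate : ∀ {n} (p : Fin n → Bool) → length (enumerate p) ≡ count p
length-enumerate {zero}  p = refl
length-enumerate {suc n} p with p fzero
... | true  = cong suc (trans (length-map fsuc (enumerate (p ∘ fsuc))) (length-enumerate (p ∘ fsuc)))
... | false = trans (length-map fsuc (enumerate (p ∘ fsuc))) (length-enumerate (p ∘ fsuc))

∈-enumerate⁻ : ∀ {n} (p : Fin n → Bool) {j} → j ∈ enumerate p → T (p j)
∈-enumerate⁻ {suc n} p j∈ with p fzero in p0
∈-enumerate⁻ {suc n} p (here refl)  | true rewrite p0 = tt
∈-enumerate⁻ {suc n} p (there j∈)   | true with ∈-map⁻ fsuc j∈
... | i , i∈ , refl = ∈-enumerate⁻ (p ∘ fsuc) i∈
∈-enumerate⁻ {suc n} p j∈           | false with ∈-map⁻ fsuc j∈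
... | i , i∈ , refl = ∈-enumerate⁻ (p ∘ fsuc) i∈

∈-enumerate⁺ : ∀ {n} (p : Fin n → Bool) {j} → T (p j) → j ∈ enumerate p
∈-enumerate⁺ {suc n} p {j} pj with p fzero in p0
∈-enumerate⁺ {suc n} p {fzero}  pj | true  = here refl
∈-enumerate⁺ {suc n} p {fsuc j} pj | true  = there (∈-map⁺ fsuc (∈-enumerate⁺ (p ∘ fsuc) pj))
∈-enumerate⁺ {suc n} p {fzero}  pj | false rewrite p0 = ⊥-elim pj
∈-enumerate⁺ {suc n} p {fsuc j} pj | false = ∈-map⁺ fsuc (∈-enumerate⁺ (p ∘ fsuc) pj)

enumerate-unique : ∀ {n} (p : Fin n → Bool) → Unique (enumerate p)
enumerate-unique {zero}  p = []
enumerate-unique {suc n} p with p fzero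
... | true  = All.tabulate zero∉ ∷ shifted
  where
  shifted : Unique (map fsuc (enumerate (p ∘ fsuc)))
  shifted = UniqueP.map⁺ FinP.suc-injective (enumerate-unique (p ∘ fsuc))
  zero∉ : ∀ {j} → j ∈ map fsuc (enumerate (p ∘ fsuc)) → fzero ≢ j
  zero∉ j∈ with ∈-map⁻ fsuc j∈
  ... | _ , _ , refl = λ ()
... | false = UniqueP.map⁺ FinP.suc-injective (enumerate-unique (p ∘ fsuc))

_≟ˢ_ : DecidableEquality Sign
pos ≟ˢ pos = yes refl
neg ≟ˢ neg = yes refl
non ≟ˢ non = yes refl
pos ≟ˢ neg = no λ ()
pos ≟ˢ non = no λ ()
neg ≟ˢ pos = no λ ()
neg ≟ˢ non = no λ ()
non ≟ˢ pos = no λ ()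
non ≟ˢ neg = no λ ()

isNeg-sound : ∀ {s} → T (isNeg s) → s ≡ neg
isNeg-sound {neg} _ = refl

isPos-sound : ∀ {s} → T (isPos s) → s ≡ pos
isPos-sound {pos} _ = refl

-- The search explores a graph from one vertex, labelling vertices 0, 1, … in order of
-- discovery.  Entry k of a `Rows` list is `just r` once the labelled vertex k is closed,
-- r giving its signs towards the labels 0 … length r - 1 (and non beyond), and is
-- `nothing` while k is open.
Row : Set
Row = List Sign

Rows : Set
Rows = List (Maybe Row)

signAt : Row → ℕ → Sign
signAt = nthOr non

rowAt : Rows → ℕ → Maybe Row
rowAt = nthOr nothing

dot : Row → Row → ℤ
dot (s ∷ r) (t ∷ q) = entry s *ℤ entry t +ℤ dot r q
dot _       _       = + 0

countRow : (Sign → Bool) → Row → ℕ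
countRow P []      = 0
countRow P (s ∷ r) = (if P s then 1 else 0) + countRow P r

-- The parameters a, b, c of a strongly regular signed graph, each known once it has been met.
record Params : Set where
  constructor params
  field a b c : Maybe ℤ

noParams : Params
noParams = params nothing nothing nothing

param : Params → Sign → Maybe ℤ
param (params a _ _) pos = a
param (params _ b _) neg = b
param (params _ _ c) non = c

agrees : Maybe ℤ → ℤ → Bool
agrees nothing           v          = true
agrees (just (+ w))      (+ v)      = w ≡ᵇ v
agrees (just ℤ.-[1+ w ]) ℤ.-[1+ v ] = w ≡ᵇ v
agrees (just _)          _          = false

agrees-refl : ∀ v → T (agrees (just v) v)
agrees-refl (+ n)      = ℕP.≡⇒≡ᵇ n n refl
agrees-refl ℤ.-[1+ n ] = ℕP.≡⇒≡ᵇ n n refl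

fits : Params → Sign → ℤ → Bool
fits p s = agrees (param p s)

learn : Sign → ℤ → Params → Params
learn pos v (params a b c) = params (a <∣> just v) b c
learn neg v (params a b c) = params a (b <∣> just v) c
learn non v (params a b c) = params a b (c <∣> just v)

firstOpen : Rows → Maybe ℕ
firstOpen []            = nothing
firstOpen (nothing ∷ _) = just 0
firstOpen (just _ ∷ rs) = Maybe.map suc (firstOpen rs)

openOthers : Rows → ℕ → List ℕ
openOthers rs x = filterᵇ (λ k → is-nothing (rowAt rs k) ∧ not (k ≡ᵇ x)) (upTo (length rs))

knownSign : ℕ → Maybe Row → Sign
knownSign x nothing  = non
knownSign x (just r) = signAt r x

initialRow : Rows → ℕ → Row
initialRow rs x = map (knownSign x) rs

touches : Row → List ℕ → Bool
touches r []       = false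
touches r (u ∷ us) = isAdj (signAt r u) ∨ touches r us

-- Once a closed row r meets no undecided position, dot row r is an entry of A², which
-- must fit the parameters.
earlyCheck : Rows → ℕ → List ℕ → Row → Params → Bool
earlyCheck []             x us row p = true
earlyCheck (nothing ∷ rs) x us row p = earlyCheck rs x us row p
earlyCheck (just r ∷ rs)  x us row p =
  (touches r us ∨ fits p (signAt r x) (dot row r)) ∧ earlyCheck rs x us row p

finalCheck : Rows → ℕ → ℕ → Row → Params → Maybe Params
finalCheck []             i x row p = just p
finalCheck (nothing ∷ rs) i x row p = finalCheck rs (suc i) x row p
finalCheck (just r ∷ rs)  i x row p =
  if i ≡ᵇ x then finalCheck rs (suc i) x row p
  else if fits p (signAt row i) (dot row r)
  then finalCheck rs (suc i) x row (learn (signAt row i) (dot row r) p)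
  else nothing

missingNeg missingPos : Row → ℕ
missingNeg row = 1 ∸ countRow isNeg row
missingPos row = 4 ∸ countRow isPos row

completeRow : Row → Row
completeRow row = row ++ (replicate (missingNeg row) neg ++ replicate (missingPos row) pos)

closeVertex : Rows → ℕ → Row → Rows
closeVertex rs x row =
  setAt rs x (just (completeRow row)) ++ replicate (missingNeg row + missingPos row) nothing

overfull : Row → Bool
overfull row = (4 <ᵇ countRow isPos row) ∨ (1 <ᵇ countRow isNeg row)

-- Out-of-range values are clamped; embeddings built from it are verified anyway.
toFin : ∀ {N} → ℕ → Fin (suc N)
toFin zero          = fzero
toFin {zero}  (suc k) = fzero
toFin {suc N} (suc k) = fsuc (toFin k)

toFinOrder : (p : Fin 5) → ℕ → Fin (order p)
toFinOrder fzero           = toFin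
toFinOrder (fsuc fzero)    = toFin
toFinOrder (fsuc (fsuc _)) = toFin

elemℕ : ℕ → List ℕ → Bool
elemℕ y []       = false
elemℕ y (k ∷ ks) = (k ≡ᵇ y) ∨ elemℕ y ks

indexOf : ℕ → List ℕ → ℕ
indexOf t []       = 0
indexOf t (a ∷ as) = if a ≡ᵇ t then 0 else suc (indexOf t as)

rowOf : Maybe Row → Row
rowOf nothing  = []
rowOf (just r) = r

module _ (p : Fin 5) where

  candSign : ℕ → ℕ → Sign
  candSign a b = cand p (toFinOrder p a) (toFinOrder p b)

  agreesWith : ℕ → Row → List ℕ → ℕ → Bool
  agreesWith t r []       y = true
  agreesWith t r (a ∷ as) y = does (candSign t a ≟ˢ signAt r y) ∧ agreesWith t r as (suc y)

  mutual
    embed : Rows → List ℕ → Maybe (List ℕ)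
    embed []       asg = just asg
    embed (r ∷ rs) asg = tryImages (rowOf r) rs asg (upTo (order p))

    tryImages : Row → Rows → List ℕ → List ℕ → Maybe (List ℕ)
    tryImages r rs asg []       = nothing
    tryImages r rs asg (t ∷ ts) =
      (if not (elemℕ t asg) ∧ agreesWith t r asg 0 then embed rs (asg ++ t ∷ []) else nothing)
      <∣> tryImages r rs asg ts

allBelow : ℕ → (ℕ → Bool) → Bool
allBelow zero    P = true
allBelow (suc m) P = P m ∧ allBelow m P

allFinᵇ : ∀ {N} → (Fin N → Bool) → Bool
allFinᵇ {zero}  P = true
allFinᵇ {suc N} P = P fzero ∧ allFinᵇ (P ∘ fsuc)

module _ (rs : Rows) (p : Fin 5) (forward backward : List ℕ) where

  forwardMap : ℕ → Fin (order p)
  forwardMap x = toFinOrder p (nthOr 0 forward x)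

  backwardMap : Fin (order p) → ℕ
  backwardMap t = nthOr 0 backward (Fin.toℕ t)

  preservesSigns leftInverse rightInverse : Bool
  preservesSigns = allBelow (length rs) λ x → allBelow (length rs) λ y →
    does (cand p (forwardMap x) (forwardMap y) ≟ˢ signAt (rowOf (rowAt rs x)) y)
  leftInverse  = allBelow (length rs) λ x → backwardMap (forwardMap x) ≡ᵇ x
  rightInverse = allFinᵇ λ t → (Fin.toℕ (forwardMap (backwardMap t)) ≡ᵇ Fin.toℕ t) ∧ (backwardMap t <ᵇ length rs)

  verify : Bool
  verify = preservesSigns ∧ leftInverse ∧ rightInverse

record Certificate (rs : Rows) : Set where
  constructor certificate
  field
    target            : Fin 5
    forward backward  : List ℕ
    valid             : T (verify rs target forward backward)

validate : (rs : Rows) (p : Fin 5) (forward backward : List ℕ) → Maybe (Certificate rs)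
validate rs p forward backward with verify rs p forward backward in ok
... | true  = just (certificate p forward backward (subst T (sym ok) tt))
... | false = nothing

certify : (rs : Rows) → Fin 5 → Maybe (Certificate rs)
certify rs p with embed p rs []
... | nothing      = nothing
... | just forward = validate rs p forward (map (λ t → indexOf t forward) (upTo (order p)))

findCertificate : (rs : Rows) → List (Fin 5) → Maybe (Certificate rs)
findCertificate rs []       = nothing
findCertificate rs (p ∷ ps) = certify rs p <∣> findCertificate rs ps

-- Depth-first search over all ways to close the first open vertex: each open label other
-- than x is made non-adjacent, positive or negative, and the remaining neighbours of x are
-- fresh vertices (one negative, the rest positive).  `true` means every branch is either
-- infeasible or ends in a graph isomorphic to one of the five candidates.
mutual
  search : ℕ → Rows → Params → Bool
  search zero       rs p = false
  search (suc fuel) rs p = searchAt fuel rs p (firstOpen rs)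

  searchAt : ℕ → Rows → Params → Maybe ℕ → Bool
  searchAt fuel rs p nothing  = is-just (findCertificate rs (allFin 5))
  searchAt fuel rs p (just x) = chooseRow fuel rs p x (openOthers rs x) (initialRow rs x)

  chooseRow : ℕ → Rows → Params → ℕ → List ℕ → Row → Bool
  chooseRow fuel rs p x us row =
    if overfull row then true
    else if earlyCheck rs x us row p then branch fuel rs p x us row else true

  branch : ℕ → Rows → Params → ℕ → List ℕ → Row → Bool
  branch fuel rs p x []       row =
    continue fuel (closeVertex rs x row) (finalCheck (closeVertex rs x row) 0 x (completeRow row) p)
  branch fuel rs p x (u ∷ us) row =
    chooseRow fuel rs p x us row ∧ chooseRow fuel rs p x us (setAt row u pos)
    ∧ chooseRow fuel rs p x us (setAt row u neg)

  continue : ℕ → Rows → Maybe Params → Bool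
  continue fuel rs nothing  = true
  continue fuel rs (just p) = search fuel rs p

-- Running out of fuel yields false, so the bound 40 needs no justification.
exhaustive : search 40 (nothing ∷ []) noParams ≡ true
exhaustive = refl

∧-elim : ∀ {a b} → T (a ∧ b) → T a × T b
∧-elim = Equivalence.to T-∧

∧-intro : ∀ {a b} → T a → T b → T (a ∧ b)
∧-intro ta tb = Equivalence.from T-∧ (ta , tb)

T-not⇒¬T : ∀ {b} → T (not b) → ¬ T b
T-not⇒¬T {false} _ ()

if-resolve : ∀ {b x} → ¬ T b → T (if b then true else x) → T x
if-resolve {true}  ¬b _ = ⊥-elim (¬b tt)
if-resolve {false} ¬b t = t

if-holds : ∀ {b x} → T b → T (if b then x else true) → T x
if-holds {true} _ t = t

does-sound : ∀ {A : Set} (d : Dec A) → T (does d) → A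
does-sound (yes a) _ = a

dot-sumTo : ∀ r q m → length r ≤ m → dot r q ≡ sumTo m (λ k → entry (signAt r k) *ℤ entry (signAt q k))
dot-sumTo []      q       m       _         = sym (sumTo-zero m (λ _ → refl))
dot-sumTo (s ∷ r) []      m       _         = sym (sumTo-zero m (λ k → ℤP.*-zeroʳ (entry (signAt (s ∷ r) k))))
dot-sumTo (s ∷ r) (t ∷ q) (suc m) (s≤s r≤m) = cong (entry s *ℤ entry t +ℤ_) (dot-sumTo r q m r≤m)

countRow-countTo : ∀ P r m → P non ≡ false → length r ≤ m → countRow P r ≡ countTo m (P ∘ signAt r)
countRow-countTo P []      m       Pnon _         = sym (countTo-zero m (λ _ → Pnon))
countRow-countTo P (s ∷ r) (suc m) Pnon (s≤s r≤m) =
  cong (λ c → (if P s then 1 else 0) + c) (countRow-countTo P r m Pnon r≤m)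

rowAt-bound : ∀ rs {y r} → rowAt rs y ≡ just r → y < length rs
rowAt-bound (q ∷ rs) {zero}  _  = s≤s z≤n
rowAt-bound (q ∷ rs) {suc y} ry = s≤s (rowAt-bound rs ry)

firstOpen-just : ∀ rs {x} → firstOpen rs ≡ just x → x < length rs × rowAt rs x ≡ nothing
firstOpen-just (nothing ∷ rs) refl = s≤s z≤n , refl
firstOpen-just (just _ ∷ rs)  eq with firstOpen rs in e
firstOpen-just (just _ ∷ rs)  refl | just x with firstOpen-just rs e
... | x<m , open-x = s≤s x<m , open-x

firstOpen-nothing : ∀ rs → firstOpen rs ≡ nothing → ∀ {k} → k < length rs → ∃[ r ] rowAt rs k ≡ just r
firstOpen-nothing (just r ∷ rs) eq {zero}  _ = r , refl
firstOpen-nothing (just r ∷ rs) eq {suc k} (s≤s k<m) with firstOpen rs in e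
firstOpen-nothing (just r ∷ rs) eq {suc k} (s≤s k<m) | nothing = firstOpen-nothing rs e k<m

∈-openOthers⁻ : ∀ rs x {k} → k ∈ openOthers rs x → k < length rs × rowAt rs k ≡ nothing × k ≢ x
∈-openOthers⁻ rs x {k} k∈ with ∈-filter⁻ (λ k → T? (is-nothing (rowAt rs k) ∧ not (k ≡ᵇ x))) k∈
... | k∈upTo , ok with rowAt rs k | ∧-elim {is-nothing (rowAt rs k)} ok
... | nothing | _ , k≢x = ∈-upTo⁻ k∈upTo , refl , λ k≡x → T-not⇒¬T k≢x (ℕP.≡⇒≡ᵇ k x k≡x)
... | just _  | () , _

∈-openOthers⁺ : ∀ rs x {k} → k < length rs → rowAt rs k ≡ nothing → k ≢ x → k ∈ openOthers rs x
∈-openOthers⁺ rs x {k} k<m open-k k≢x =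
  ∈-filter⁺ (λ k → T? (is-nothing (rowAt rs k) ∧ not (k ≡ᵇ x))) (∈-upTo⁺ k<m) ok
  where
  ok : T (is-nothing (rowAt rs k) ∧ not (k ≡ᵇ x))
  ok rewrite open-k with k ≡ᵇ x in e
  ... | true  = k≢x (ℕP.≡ᵇ⇒≡ k x (subst T (sym e) tt))
  ... | false = tt

openOthers-unique : ∀ rs x → Unique (openOthers rs x)
openOthers-unique rs x = UniqueP.filter⁺ _ (UniqueP.upTo⁺ (length rs))

touches-false : ∀ r us → ¬ T (touches r us) → ∀ {u} → u ∈ us → signAt r u ≡ non
touches-false r (u ∷ us) ¬t (here refl) with signAt r u
... | non = refl
... | pos = ⊥-elim (¬t tt)
... | neg = ⊥-elim (¬t tt)
touches-false r (u ∷ us) ¬t (there u∈) with isAdj (signAt r u)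
... | true  = ⊥-elim (¬t tt)
... | false = touches-false r us ¬t u∈

signAt-initialRow : ∀ rs x k → signAt (initialRow rs x) k ≡ knownSign x (rowAt rs k)
signAt-initialRow []       x k       = refl
signAt-initialRow (r ∷ rs) x zero    = refl
signAt-initialRow (r ∷ rs) x (suc k) = signAt-initialRow rs x k

earlyCheck-intro : ∀ rs x us row p →
  (∀ {y r} → rowAt rs y ≡ just r → T (touches r us ∨ fits p (signAt r x) (dot row r))) →
  T (earlyCheck rs x us row p)
earlyCheck-intro []             x us row p ok = tt
earlyCheck-intro (nothing ∷ rs) x us row p ok = earlyCheck-intro rs x us row p (λ {y} → ok {suc y})
earlyCheck-intro (just r ∷ rs)  x us row p ok =
  ∧-intro (ok {0} refl) (earlyCheck-intro rs x us row p (λ {y} → ok {suc y}))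

allBelow-sound : ∀ m P → T (allBelow m P) → ∀ {k} → k < m → T (P k)
allBelow-sound (suc m) P ok {k} k<1+m with k ℕP.≟ m | ∧-elim {P m} ok
... | yes refl | Pm , _    = Pm
... | no  k≢m  | _  , rest = allBelow-sound m P rest (ℕP.≤∧≢⇒< (ℕP.≤-pred k<1+m) k≢m)

allFinᵇ-sound : ∀ {N} (P : Fin N → Bool) → T (allFinᵇ P) → ∀ t → T (P t)
allFinᵇ-sound P ok fzero    = proj₁ (∧-elim {P fzero} ok)
allFinᵇ-sound P ok (fsuc t) = allFinᵇ-sound (P ∘ fsuc) (proj₂ (∧-elim {P fzero} ok)) t

fromJust : ∀ {A : Set} (m : Maybe A) → T (is-just m) → A
fromJust (just a) _ = a

module _ (par : Sign → ℤ) where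

  Respects : Params → Set
  Respects p = ∀ s {v} → param p s ≡ just v → v ≡ par s

  noParams-respects : Respects noParams
  noParams-respects pos ()
  noParams-respects neg ()
  noParams-respects non ()

  fits-par : ∀ {p} → Respects p → ∀ s → T (fits p s (par s))
  fits-par {p} resp s with param p s in e
  ... | nothing = tt
  ... | just w rewrite resp s e = agrees-refl (par s)

  learned : ∀ {a s} → (∀ {v} → a ≡ just v → v ≡ par s) → ∀ {v} → (a <∣> just (par s)) ≡ just v → v ≡ par s
  learned {just w}  old eq   = old eq
  learned {nothing} old refl = refl

  learn-respects : ∀ {p} → Respects p → ∀ s → Respects (learn s (par s) p)
  learn-respects {params _ _ _} resp pos pos = learned (resp pos)
  learn-respects {params _ _ _} resp pos neg = resp neg
  learn-respects {params _ _ _} resp pos non = resp non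
  learn-respects {params _ _ _} resp neg pos = resp pos
  learn-respects {params _ _ _} resp neg neg = learned (resp neg)
  learn-respects {params _ _ _} resp neg non = resp non
  learn-respects {params _ _ _} resp non pos = resp pos
  learn-respects {params _ _ _} resp non neg = resp neg
  learn-respects {params _ _ _} resp non non = learned (resp non)

  -- The entries of A² that finalCheck compares with the parameters, from label i on.
  record FinalEntries (rs : Rows) (i x : ℕ) (row : Row) : Set where
    field entry≡par : ∀ {y r} → rowAt rs y ≡ just r → i + y ≢ x → dot row r ≡ par (signAt row (i + y))
  open FinalEntries

  FinalEntries-tail : ∀ {q rs i x row} → FinalEntries (q ∷ rs) i x row → FinalEntries rs (suc i) x row
  FinalEntries-tail {i = i} {row = row} ok .entry≡par {y} {r} ry i+y≢x =
    subst (λ k → dot row r ≡ par (signAt row k)) (ℕP.+-suc i y)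
          (entry≡par ok {suc y} ry (λ eq → i+y≢x (trans (sym (ℕP.+-suc i y)) eq)))

  FinalEntries-head : ∀ {r rs i x row} → FinalEntries (just r ∷ rs) i x row → i ≢ x → dot row r ≡ par (signAt row i)
  FinalEntries-head {r} {i = i} {row = row} ok i≢x =
    subst (λ k → dot row r ≡ par (signAt row k)) (ℕP.+-identityʳ i)
          (entry≡par ok {0} refl (λ eq → i≢x (trans (sym (ℕP.+-identityʳ i)) eq)))

  Succeeds : Maybe Params → Set
  Succeeds mp = ∃[ p′ ] mp ≡ just p′ × Respects p′

  fits-then-learn : ∀ {p} → Respects p → ∀ s {v} → v ≡ par s → (k : Params → Maybe Params) →
                    (∀ {p′} → Respects p′ → Succeeds (k p′)) →
                    Succeeds (if fits p s v then k (learn s v p) else nothing)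
  fits-then-learn {p} resp s refl k cont with fits p s (par s) in fit
  ... | true  = cont (learn-respects resp s)
  ... | false = ⊥-elim (subst T fit (fits-par resp s))

  finalCheck-succeeds : ∀ rs i x row {p} → Respects p → FinalEntries rs i x row → Succeeds (finalCheck rs i x row p)
  finalCheck-succeeds []             i x row resp ok = _ , refl , resp
  finalCheck-succeeds (nothing ∷ rs) i x row resp ok = finalCheck-succeeds rs (suc i) x row resp (FinalEntries-tail ok)
  finalCheck-succeeds (just r ∷ rs)  i x row resp ok with i ≡ᵇ x in i≟x
  ... | true  = finalCheck-succeeds rs (suc i) x row resp (FinalEntries-tail ok)
  ... | false = fits-then-learn resp (signAt row i) (FinalEntries-head ok (λ i≡x → subst T i≟x (ℕP.≡⇒≡ᵇ i x i≡x)))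
                  (finalCheck rs (suc i) x row)
                  (λ resp′ → finalCheck-succeeds rs (suc i) x row resp′ (FinalEntries-tail ok))

module Exploration {n : ℕ} (σ : Fin n → Fin n → Sign) (simple : IsSimple σ) (connected : Connected σ)
  (pos-degree : ∀ i → count (isPos ∘ σ i) ≡ 4) (neg-degree : ∀ i → count (isNeg ∘ σ i) ≡ 1)
  (par : Sign → ℤ) (sq-par : ∀ i j → i ≢ j → sq σ i j ≡ par (σ i j)) where

  σ-sym : ∀ i j → σ i j ≡ σ j i
  σ-sym = proj₁ simple

  σ-loop : ∀ i → σ i i ≡ non
  σ-loop = proj₂ simple

  -- Label k of the search stands for the vertex ρ k; a closed vertex has its true row and
  -- all its neighbours labelled.
  record Describes (rs : Rows) (ρ : ℕ → Fin n) : Set where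
    field
      injective  : InjectiveBelow (length rs) ρ
      row-signs  : ∀ {x r} → rowAt rs x ≡ just r → ∀ {k} → k < length rs → σ (ρ x) (ρ k) ≡ signAt r k
      row-closed : ∀ {x r} → rowAt rs x ≡ just r → ∀ j → OutsideImage (length rs) ρ j → σ (ρ x) j ≡ non
      row-length : ∀ {x r} → rowAt rs x ≡ just r → length r ≤ length rs
  open Describes

  sq-closed : ∀ {rs ρ y r} → Describes rs ρ → rowAt rs y ≡ just r → ∀ i →
              sq σ i (ρ y) ≡ sumTo (length rs) (λ k → entry (σ i (ρ k)) *ℤ entry (signAt r k))
  sq-closed {rs} {ρ} {y} {r} D ry i =
    trans (sumℤ-reindex (length rs) ρ _ (injective D) vanish)
          (sumTo-cong (length rs) λ k k<m → cong (λ s → entry (σ i (ρ k)) *ℤ entry s)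
                                                   (trans (σ-sym (ρ k) (ρ y)) (row-signs D ry k<m)))
    where
    vanish : ∀ j → OutsideImage (length rs) ρ j → entry (σ i j) *ℤ entry (σ j (ρ y)) ≡ + 0
    vanish j out rewrite σ-sym j (ρ y) | row-closed D ry j out = ℤP.*-zeroʳ (entry (σ i j))

  sq≡dot : ∀ {rs ρ y r} → Describes rs ρ → rowAt rs y ≡ just r → ∀ x row → length row ≤ length rs →
           (∀ {k} → k < length rs →
              entry (signAt row k) *ℤ entry (signAt r k) ≡ entry (σ (ρ x) (ρ k)) *ℤ entry (signAt r k)) →
           sq σ (ρ x) (ρ y) ≡ dot row r
  sq≡dot {rs} {r = r} D ry x row row≤m agree =
    trans (sq-closed D ry _) (sym (trans (dot-sumTo row r (length rs) row≤m) (sumTo-cong (length rs) λ k → agree)))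

  closed≢open : ∀ {rs ρ x y r} → Describes rs ρ → x < length rs → rowAt rs x ≡ nothing → rowAt rs y ≡ just r → ρ x ≢ ρ y
  closed≢open {rs} D x<m x-open ry eq with injective D x<m (rowAt-bound rs ry) eq
  ... | refl with trans (sym x-open) ry
  ...   | ()

  isLabelled : (ℕ → Fin n) → ℕ → Fin n → Bool
  isLabelled ρ m j = does (ℕP.anyUpTo? (λ k → ρ k Fin.≟ j) m)

  isLabelled-image : ∀ ρ {m k} → k < m → isLabelled ρ m (ρ k) ≡ true
  isLabelled-image ρ {m} {k} k<m = dec-true (ℕP.anyUpTo? (λ k → ρ k Fin.≟ ρ _) m) (k , k<m , refl)

  isLabelled-outside : ∀ ρ {m j} → OutsideImage m ρ j → isLabelled ρ m j ≡ false
  isLabelled-outside ρ {m} {j} out = dec-false (ℕP.anyUpTo? (λ k → ρ k Fin.≟ j) m) λ (k , k<m , eq) → out k k<m eq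

  unlabelled⇒outside : ∀ ρ {m j} → T (not (isLabelled ρ m j)) → OutsideImage m ρ j
  unlabelled⇒outside ρ {m} {j} unl k k<m eq =
    T-not⇒¬T unl (subst T (sym (dec-true (ℕP.anyUpTo? (λ k → ρ k Fin.≟ j) m) (k , k<m , eq))) tt)

  count-labelled : ∀ {m ρ} → InjectiveBelow m ρ → ∀ (P : Sign → Bool) i →
    count (P ∘ σ i) ≡ countTo m (P ∘ σ i ∘ ρ) + count (λ j → P (σ i j) ∧ not (isLabelled ρ m j))
  count-labelled {m} {ρ} inj P i =
    trans (count-split (P ∘ σ i) (isLabelled ρ m))
          (cong (_+ count (λ j → P (σ i j) ∧ not (isLabelled ρ m j)))
                (trans (count-reindex m ρ _ inj λ j out → trans (cong (P (σ i j) ∧_) (isLabelled-outside ρ out)) (∧-zeroʳ _))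
                       (countTo-cong m λ k k<m → trans (cong (P (σ i (ρ k)) ∧_) (isLabelled-image ρ k<m)) (∧-identityʳ _))))

  record PartialRow (rs : Rows) (ρ : ℕ → Fin n) (x : ℕ) (us : List ℕ) (row : Row) : Set where
    field
      length-row : length row ≡ length rs
      decided    : ∀ {k} → k < length rs → k ∉ us → signAt row k ≡ σ (ρ x) (ρ k)
      undecided  : ∀ {k} → k ∈ us → signAt row k ≡ non
      undecided< : ∀ {k} → k ∈ us → k < length rs
      distinct   : Unique us
  open PartialRow

  countRow-bound : ∀ {rs ρ x us row} → Describes rs ρ → PartialRow rs ρ x us row → ∀ P → P non ≡ false →
                   countRow P row ≤ count (P ∘ σ (ρ x))
  countRow-bound {rs} {ρ} {x} {us} {row} D R P Pnon = begin
    countRow P row                       ≡⟨ countRow-countTo P row m Pnon (ℕP.≤-reflexive (length-row R)) ⟩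
    countTo m (P ∘ signAt row)           ≤⟨ countTo-mono m below ⟩
    countTo m (P ∘ σ (ρ x) ∘ ρ)          ≤⟨ ℕP.m≤m+n _ _ ⟩
    countTo m (P ∘ σ (ρ x) ∘ ρ) + _      ≡⟨ count-labelled (injective D) P (ρ x) ⟨
    count (P ∘ σ (ρ x))                  ∎
    where
    open ℕP.≤-Reasoning
    m = length rs
    below : ∀ k → k < m → T (P (signAt row k)) → T (P (σ (ρ x) (ρ k)))
    below k k<m Pk with k ∈? us
    ... | yes k∈ = ⊥-elim (subst T (trans (cong P (undecided R k∈)) Pnon) Pk)
    ... | no  k∉ = subst (T ∘ P) (decided R k<m k∉) Pk

  not-overfull : ∀ {rs ρ x us row} → Describes rs ρ → PartialRow rs ρ x us row → ¬ T (overfull row)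
  not-overfull {ρ = ρ} {x} {row = row} D R t with Equivalence.to T-∨ t
  ... | inj₁ 4<pos = ℕP.<⇒≱ (ℕP.<ᵇ⇒< 4 _ 4<pos)
                       (subst (countRow isPos row ≤_) (pos-degree (ρ x)) (countRow-bound D R isPos refl))
  ... | inj₂ 1<neg = ℕP.<⇒≱ (ℕP.<ᵇ⇒< 1 _ 1<neg)
                       (subst (countRow isNeg row ≤_) (neg-degree (ρ x)) (countRow-bound D R isNeg refl))

  early-passes : ∀ {rs ρ x us row p} → Describes rs ρ → Respects par p → x < length rs → rowAt rs x ≡ nothing →
                 PartialRow rs ρ x us row → T (earlyCheck rs x us row p)
  early-passes {rs} {ρ} {x} {us} {row} {p} D resp x<m x-open R = earlyCheck-intro rs x us row p entry-fits
    where
    entry-fits : ∀ {y r} → rowAt rs y ≡ just r → T (touches r us ∨ fits p (signAt r x) (dot row r))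
    entry-fits {y} {r} ry with touches r us in t
    ... | true  = tt
    ... | false = subst (T ∘ fits p (signAt r x)) (sym dot≡par) (fits-par par resp (signAt r x))
      where
      agree : ∀ {k} → k < length rs →
              entry (signAt row k) *ℤ entry (signAt r k) ≡ entry (σ (ρ x) (ρ k)) *ℤ entry (signAt r k)
      agree {k} k<m with k ∈? us
      ... | yes k∈ rewrite touches-false r us (subst T t) k∈ =
        trans (ℤP.*-zeroʳ (entry (signAt row k))) (sym (ℤP.*-zeroʳ (entry (σ (ρ x) (ρ k)))))
      ... | no  k∉ rewrite decided R k<m k∉ = refl

      dot≡par : dot row r ≡ par (signAt r x)
      dot≡par = begin
        dot row r            ≡⟨ sq≡dot D ry x row (ℕP.≤-reflexive (length-row R)) agree ⟨
        sq σ (ρ x) (ρ y)     ≡⟨ sq-par _ _ (closed≢open D x<m x-open ry) ⟩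
        par (σ (ρ x) (ρ y))  ≡⟨ cong par (trans (σ-sym _ _) (row-signs D ry x<m)) ⟩
        par (signAt r x)     ∎
        where open ≡-Reasoning

  initialRow-partial : ∀ {rs ρ x} → Describes rs ρ → x < length rs → rowAt rs x ≡ nothing →
                       PartialRow rs ρ x (openOthers rs x) (initialRow rs x)
  initialRow-partial {rs} {ρ} {x} D x<m x-open = record
    { length-row = length-map (knownSign x) rs
    ; decided    = decided′
    ; undecided  = undecided′
    ; undecided< = proj₁ ∘ ∈-openOthers⁻ rs x
    ; distinct   = openOthers-unique rs x
    }
    where
    decided′ : ∀ {k} → k < length rs → k ∉ openOthers rs x → signAt (initialRow rs x) k ≡ σ (ρ x) (ρ k)
    decided′ {k} k<m k∉ rewrite signAt-initialRow rs x k with rowAt rs k in rk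
    ... | just r = sym (trans (σ-sym _ _) (row-signs D rk x<m))
    ... | nothing with k ℕP.≟ x
    ...   | yes refl = sym (σ-loop (ρ k))
    ...   | no  k≢x  = ⊥-elim (k∉ (∈-openOthers⁺ rs x k<m rk k≢x))

    undecided′ : ∀ {k} → k ∈ openOthers rs x → signAt (initialRow rs x) k ≡ non
    undecided′ {k} k∈ rewrite signAt-initialRow rs x k | proj₁ (proj₂ (∈-openOthers⁻ rs x k∈)) = refl

  PartialRow-skip : ∀ {rs ρ x u us row} → PartialRow rs ρ x (u ∷ us) row → σ (ρ x) (ρ u) ≡ non →
                    PartialRow rs ρ x us row
  PartialRow-skip {rs} {ρ} {x} {u} {us} {row} R u-non = record
    { length-row = length-row R
    ; decided    = decided′
    ; undecided  = undecided R ∘ there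
    ; undecided< = undecided< R ∘ there
    ; distinct   = AllPairs.tail (distinct R)
    }
    where
    decided′ : ∀ {k} → k < length rs → k ∉ us → signAt row k ≡ σ (ρ x) (ρ k)
    decided′ {k} k<m k∉ with k ℕP.≟ u
    ... | yes refl = trans (undecided R (here refl)) (sym u-non)
    ... | no  k≢u  = decided R k<m (∉-∷ k≢u k∉)

  PartialRow-set : ∀ {rs ρ x u us row s} → PartialRow rs ρ x (u ∷ us) row → σ (ρ x) (ρ u) ≡ s →
                   PartialRow rs ρ x us (setAt row u s)
  PartialRow-set {rs} {ρ} {x} {u} {us} {row} {s} R u-s = record
    { length-row = trans (length-setAt row u s) (length-row R)
    ; decided    = decided′
    ; undecided  = undecided′
    ; undecided< = undecided< R ∘ there
    ; distinct   = AllPairs.tail (distinct R)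
    }
    where
    u∉us : ∀ {k} → k ∈ us → u ≢ k
    u∉us = All.lookup (AllPairs.head (distinct R))
    decided′ : ∀ {k} → k < length rs → k ∉ us → signAt (setAt row u s) k ≡ σ (ρ x) (ρ k)
    decided′ {k} k<m k∉ with k ℕP.≟ u
    ... | yes refl = trans (nthOr-setAt-here non row s (subst (k <_) (sym (length-row R)) (undecided< R (here refl))))
                           (sym u-s)
    ... | no  k≢u  = trans (nthOr-setAt-there non row s k≢u) (decided R k<m (∉-∷ k≢u k∉))
    undecided′ : ∀ {k} → k ∈ us → signAt (setAt row u s) k ≡ non
    undecided′ k∈ = trans (nthOr-setAt-there non row s (u∉us k∈ ∘ sym)) (undecided R (there k∈))

  -- The fresh neighbours of x receive the new labels m, m + 1, …, the negative one first, in
  -- the order in which completeRow appends their signs.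
  module Closing {rs ρ} (D : Describes rs ρ) {x} (x<m : x < length rs) (x-open : rowAt rs x ≡ nothing)
                 (row : Row) (length-row : length row ≡ length rs)
                 (row-true : ∀ {k} → k < length rs → signAt row k ≡ σ (ρ x) (ρ k)) where

    m : ℕ
    m = length rs

    isFresh : (Sign → Bool) → Fin n → Bool
    isFresh P j = P (σ (ρ x) j) ∧ not (isLabelled ρ m j)

    fresh : (Sign → Bool) → List (Fin n)
    fresh P = enumerate (isFresh P)

    fresh-sign : ∀ P {s} → (∀ {t} → T (P t) → t ≡ s) → ∀ {j} → j ∈ fresh P → σ (ρ x) j ≡ s
    fresh-sign P sound j∈ = sound (proj₁ (∧-elim (∈-enumerate⁻ (isFresh P) j∈)))

    fresh-outside : ∀ P {j} → j ∈ fresh P → OutsideImage m ρ j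
    fresh-outside P j∈ = unlabelled⇒outside ρ (proj₂ (∧-elim {P (σ (ρ x) _)} (∈-enumerate⁻ (isFresh P) j∈)))

    fresh-complete : ∀ P {j} → T (P (σ (ρ x) j)) → OutsideImage m ρ j → j ∈ fresh P
    fresh-complete P Pj out = ∈-enumerate⁺ (isFresh P) (∧-intro Pj (subst (T ∘ not) (sym (isLabelled-outside ρ out)) tt))

    length-fresh : ∀ P {d} → P non ≡ false → count (P ∘ σ (ρ x)) ≡ d → length (fresh P) ≡ d ∸ countRow P row
    length-fresh P {d} Pnon deg = begin
      length (fresh P)              ≡⟨ length-enumerate (isFresh P) ⟩
      count (isFresh P)             ≡⟨ ℕP.m+n∸m≡n (countTo m (P ∘ σ (ρ x) ∘ ρ)) _ ⟨
      countTo m (P ∘ σ (ρ x) ∘ ρ) + count (isFresh P) ∸ countTo m (P ∘ σ (ρ x) ∘ ρ)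
                                    ≡⟨ cong₂ _∸_ (trans (sym (count-labelled (injective D) P (ρ x))) deg) (sym labelled-count) ⟩
      d ∸ countRow P row            ∎
      where
      open ≡-Reasoning
      labelled-count : countRow P row ≡ countTo m (P ∘ σ (ρ x) ∘ ρ)
      labelled-count = trans (countRow-countTo P row m Pnon (ℕP.≤-reflexive length-row))
                             (countTo-cong m λ k k<m → cong P (row-true k<m))

    newcomers : List (Fin n)
    newcomers = fresh isNeg ++ fresh isPos

    newcomers-unique : Unique newcomers
    newcomers-unique = UniqueP.++⁺ (enumerate-unique _) (enumerate-unique _) λ (j∈neg , j∈pos) →
      case trans (sym (fresh-sign isNeg isNeg-sound j∈neg)) (fresh-sign isPos isPos-sound j∈pos) of λ ()

    newcomers-outside : ∀ {j} → j ∈ newcomers → OutsideImage m ρ j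
    newcomers-outside j∈ with ∈-++⁻ (fresh isNeg) j∈
    ... | inj₁ j∈neg = fresh-outside isNeg j∈neg
    ... | inj₂ j∈pos = fresh-outside isPos j∈pos

    completeRow≡ : completeRow row ≡ row ++ map (σ (ρ x)) newcomers
    completeRow≡ = cong (row ++_) (sym (begin
      map (σ (ρ x)) (fresh isNeg ++ fresh isPos)
        ≡⟨ map-++ (σ (ρ x)) (fresh isNeg) (fresh isPos) ⟩
      map (σ (ρ x)) (fresh isNeg) ++ map (σ (ρ x)) (fresh isPos)
        ≡⟨ cong₂ _++_ (map-const-on _ _ (fresh-sign isNeg isNeg-sound)) (map-const-on _ _ (fresh-sign isPos isPos-sound)) ⟩
      replicate (length (fresh isNeg)) neg ++ replicate (length (fresh isPos)) pos
        ≡⟨ cong₂ (λ a b → replicate a neg ++ replicate b pos)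
                 (length-fresh isNeg refl (neg-degree (ρ x))) (length-fresh isPos refl (pos-degree (ρ x))) ⟩
      replicate (missingNeg row) neg ++ replicate (missingPos row) pos ∎))
      where open ≡-Reasoning

    ρ′ : ℕ → Fin n
    ρ′ k = if k <ᵇ m then ρ k else nthOr (ρ x) newcomers (k ∸ m)

    ρ′-old : ∀ {k} → k < m → ρ′ k ≡ ρ k
    ρ′-old {k} k<m with k <ᵇ m | ℕP.<⇒<ᵇ k<m
    ... | true | _ = refl

    ρ′-new : ∀ t → ρ′ (m + t) ≡ nthOr (ρ x) newcomers t
    ρ′-new t with (m + t) <ᵇ m in lt
    ... | true  = ⊥-elim (ℕP.<⇒≱ (ℕP.<ᵇ⇒< (m + t) m (subst T (sym lt) tt)) (ℕP.m≤m+n m t))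
    ... | false = cong (nthOr (ρ x) newcomers) (ℕP.m+n∸m≡n m t)

    rows′ : Rows
    rows′ = closeVertex rs x row

    m′ : ℕ
    m′ = m + length newcomers

    length-rows′ : length rows′ ≡ m′
    length-rows′ = begin
      length rows′  ≡⟨ length-++ (setAt rs x _) ⟩
      length (setAt rs x _) + length (replicate (missingNeg row + missingPos row) nothing)
                    ≡⟨ cong₂ _+_ (length-setAt rs x _) (length-replicate _) ⟩
      m + (missingNeg row + missingPos row)
                    ≡⟨ cong (_+_ m) (cong₂ _+_ (length-fresh isNeg refl (neg-degree (ρ x)))
                                              (length-fresh isPos refl (pos-degree (ρ x)))) ⟨
      m + (length (fresh isNeg) + length (fresh isPos))
                    ≡⟨ cong (_+_ m) (length-++ (fresh isNeg)) ⟨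
      m′            ∎
      where open ≡-Reasoning

    R′ : Row
    R′ = completeRow row

    length-R′ : length R′ ≡ m′
    length-R′ = trans (cong length completeRow≡)
                      (trans (length-++ row) (cong₂ _+_ length-row (length-map (σ (ρ x)) newcomers)))

    length-setAt-rs : length (setAt rs x (just R′)) ≡ m
    length-setAt-rs = length-setAt rs x (just R′)

    rowAt-x : rowAt rows′ x ≡ just R′
    rowAt-x = trans (nthOr-++ˡ nothing (setAt rs x _) _ (subst (x <_) (sym length-setAt-rs) x<m))
                    (nthOr-setAt-here nothing rs (just R′) x<m)

    rowAt-rows′ : ∀ {y r} → rowAt rows′ y ≡ just r → (y ≡ x × r ≡ R′) ⊎ (y < m × rowAt rs y ≡ just r)
    rowAt-rows′ {y} {r} ry with y ℕP.<? m
    ... | yes y<m with y ℕP.≟ x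
    ...   | yes refl = inj₁ (refl , just-injective (trans (sym ry) rowAt-x))
    ...   | no  y≢x  = inj₂ (y<m , trans (sym old) ry)
      where
      old : rowAt rows′ y ≡ rowAt rs y
      old = trans (nthOr-++ˡ nothing (setAt rs x _) _ (subst (y <_) (sym length-setAt-rs) y<m))
                  (nthOr-setAt-there nothing rs _ y≢x)
    rowAt-rows′ {y} {r} ry | no y≮m = case trans (sym ry) new of λ ()
      where
      open ≡-Reasoning
      new : rowAt rows′ y ≡ nothing
      new = begin
        rowAt rows′ y                        ≡⟨ cong (rowAt rows′) (ℕP.m+[n∸m]≡n (ℕP.≮⇒≥ y≮m)) ⟨
        rowAt rows′ (m + (y ∸ m))            ≡⟨ cong (λ l → rowAt rows′ (l + (y ∸ m))) length-setAt-rs ⟨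
        rowAt rows′ (length (setAt rs x (just R′)) + (y ∸ m))
                                             ≡⟨ nthOr-++ʳ nothing (setAt rs x _) _ (y ∸ m) ⟩
        nthOr nothing (replicate (missingNeg row + missingPos row) nothing) (y ∸ m)
                                             ≡⟨ nthOr-replicate nothing (missingNeg row + missingPos row) (y ∸ m) ⟩
        nothing                              ∎

    nthOr-newcomers-∈ : ∀ {t} → t < length newcomers → nthOr (ρ x) newcomers t ∈ newcomers
    nthOr-newcomers-∈ = nthOr-∈ (ρ x) newcomers

    injective′ : InjectiveBelow m′ ρ′
    injective′ {k} {l} k< l< eq with split< m (length newcomers) k< | split< m (length newcomers) l<
    ... | inj₁ k<m | inj₁ l<m = injective D k<m l<m (trans (sym (ρ′-old k<m)) (trans eq (ρ′-old l<m)))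
    ... | inj₁ k<m | inj₂ (t , refl , t<) =
      ⊥-elim (newcomers-outside (nthOr-newcomers-∈ t<) k k<m (trans (sym (ρ′-old k<m)) (trans eq (ρ′-new t))))
    ... | inj₂ (t , refl , t<) | inj₁ l<m =
      ⊥-elim (newcomers-outside (nthOr-newcomers-∈ t<) l l<m (trans (sym (ρ′-old l<m)) (trans (sym eq) (ρ′-new t))))
    ... | inj₂ (t , refl , t<) | inj₂ (u , refl , u<) =
      cong (_+_ m) (nthOr-injective (ρ x) newcomers-unique t< u< (trans (sym (ρ′-new t)) (trans eq (ρ′-new u))))

    R′-signs : ∀ {k} → k < m′ → σ (ρ′ x) (ρ′ k) ≡ signAt R′ k
    R′-signs {k} k< rewrite ρ′-old x<m | completeRow≡ with split< m (length newcomers) k<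
    ... | inj₁ k<m = begin
      σ (ρ x) (ρ′ k)                      ≡⟨ cong (σ (ρ x)) (ρ′-old k<m) ⟩
      σ (ρ x) (ρ k)                       ≡⟨ row-true k<m ⟨
      signAt row k                        ≡⟨ nthOr-++ˡ non row _ (subst (k <_) (sym length-row) k<m) ⟨
      signAt (row ++ map (σ (ρ x)) newcomers) k ∎
      where open ≡-Reasoning
    ... | inj₂ (t , refl , t<) = begin
      σ (ρ x) (ρ′ (m + t))                ≡⟨ cong (σ (ρ x)) (ρ′-new t) ⟩
      σ (ρ x) (nthOr (ρ x) newcomers t)   ≡⟨ nthOr-map (σ (ρ x)) (ρ x) non newcomers t< ⟨
      signAt (map (σ (ρ x)) newcomers) t  ≡⟨ nthOr-++ʳ non row _ t ⟨
      signAt (row ++ map (σ (ρ x)) newcomers) (length row + t)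
                                          ≡⟨ cong (λ l → signAt (row ++ map (σ (ρ x)) newcomers) (l + t)) length-row ⟩
      signAt (row ++ map (σ (ρ x)) newcomers) (m + t) ∎
      where open ≡-Reasoning

    old-signs : ∀ {y r} → y < m → rowAt rs y ≡ just r → ∀ {k} → k < m′ → σ (ρ′ y) (ρ′ k) ≡ signAt r k
    old-signs {y} {r} y<m ry {k} k< rewrite ρ′-old y<m with split< m (length newcomers) k<
    ... | inj₁ k<m = trans (cong (σ (ρ y)) (ρ′-old k<m)) (row-signs D ry k<m)
    ... | inj₂ (t , refl , t<) =
      trans (cong (σ (ρ y)) (ρ′-new t))
            (trans (row-closed D ry _ (newcomers-outside (nthOr-newcomers-∈ t<)))
                   (sym (nthOr-beyond non r (ℕP.≤-trans (row-length D ry) (ℕP.m≤m+n m t)))))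

    outside′⇒outside : ∀ {j} → OutsideImage m′ ρ′ j → OutsideImage m ρ j
    outside′⇒outside out k k<m eq = out k (ℕP.<-≤-trans k<m (ℕP.m≤m+n m _)) (trans (ρ′-old k<m) eq)

    newcomer-labelled : ∀ {j} → j ∈ newcomers → ¬ OutsideImage m′ ρ′ j
    newcomer-labelled j∈ out with ∈⇒nthOr (ρ x) j∈
    ... | t , t< , eq = out (m + t) (ℕP.+-monoʳ-< m t<) (trans (ρ′-new t) eq)

    outside′⇒non : ∀ {j} → OutsideImage m′ ρ′ j → σ (ρ x) j ≡ non
    outside′⇒non {j} out with σ (ρ x) j in sign
    ... | non = refl
    ... | neg = ⊥-elim (newcomer-labelled
                  (∈-++⁺ˡ (fresh-complete isNeg (subst (T ∘ isNeg) (sym sign) tt) (outside′⇒outside out))) out)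
    ... | pos = ⊥-elim (newcomer-labelled
                  (∈-++⁺ʳ (fresh isNeg) (fresh-complete isPos (subst (T ∘ isPos) (sym sign) tt) (outside′⇒outside out))) out)

    describes′ : Describes rows′ ρ′
    describes′ = record
      { injective  = λ k< l< → injective′ (subst (_ <_) length-rows′ k<) (subst (_ <_) length-rows′ l<)
      ; row-signs  = signs′
      ; row-closed = closed′
      ; row-length = length′
      }
      where
      signs′ : ∀ {y r} → rowAt rows′ y ≡ just r → ∀ {k} → k < length rows′ → σ (ρ′ y) (ρ′ k) ≡ signAt r k
      signs′ ry k< with rowAt-rows′ ry
      ... | inj₁ (refl , refl) = R′-signs (subst (_ <_) length-rows′ k<)
      ... | inj₂ (y<m , ry₀)   = old-signs y<m ry₀ (subst (_ <_) length-rows′ k<)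

      closed′ : ∀ {y r} → rowAt rows′ y ≡ just r → ∀ j → OutsideImage (length rows′) ρ′ j → σ (ρ′ y) j ≡ non
      closed′ ry j out with rowAt-rows′ ry | subst (λ l → OutsideImage l ρ′ j) length-rows′ out
      ... | inj₁ (refl , refl) | out′ = trans (cong (λ v → σ v j) (ρ′-old x<m)) (outside′⇒non out′)
      ... | inj₂ (y<m , ry₀)   | out′ = trans (cong (λ v → σ v j) (ρ′-old y<m)) (row-closed D ry₀ j (outside′⇒outside out′))

      length′ : ∀ {y r} → rowAt rows′ y ≡ just r → length r ≤ length rows′
      length′ ry with rowAt-rows′ ry
      ... | inj₁ (refl , refl) = ℕP.≤-reflexive (trans length-R′ (sym length-rows′))
      ... | inj₂ (_ , ry₀)     = ℕP.≤-trans (row-length D ry₀) (subst (m ≤_) (sym length-rows′) (ℕP.m≤m+n m _))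

    final-entries : FinalEntries par rows′ 0 x R′
    final-entries = record { entry≡par = entry≡par′ }
      where
      x<m′ : x < length rows′
      x<m′ = rowAt-bound rows′ rowAt-x

      entry≡par′ : ∀ {y r} → rowAt rows′ y ≡ just r → y ≢ x → dot R′ r ≡ par (signAt R′ y)
      entry≡par′ {y} {r} ry y≢x = begin
        dot R′ r                ≡⟨ sq≡dot describes′ ry x R′ (ℕP.≤-reflexive (trans length-R′ (sym length-rows′)))
                                          (λ k< → cong (λ s → entry s *ℤ _) (sym (row-signs describes′ rowAt-x k<))) ⟨
        sq σ (ρ′ x) (ρ′ y)      ≡⟨ sq-par _ _ (λ eq → y≢x (sym (injective describes′ x<m′ (rowAt-bound rows′ ry) eq))) ⟩
        par (σ (ρ′ x) (ρ′ y))   ≡⟨ cong par (row-signs describes′ rowAt-x (rowAt-bound rows′ ry)) ⟩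
        par (signAt R′ y)       ∎
        where open ≡-Reasoning

  Labelled : ℕ → (ℕ → Fin n) → Fin n → Set
  Labelled m ρ j = ∃[ k ] k < m × ρ k ≡ j

  module Leaf {rs ρ} (D : Describes rs ρ) (nonempty : 0 < length rs)
              (all-closed : ∀ {k} → k < length rs → ∃[ r ] rowAt rs k ≡ just r) where

    m : ℕ
    m = length rs

    -- A neighbour of a labelled vertex is labelled, because every labelled vertex is closed.
    reach-labelled : ∀ {i j} → Reach σ i j → Labelled m ρ i → Labelled m ρ j
    reach-labelled here lab = lab
    reach-labelled (step {j = j} adj path) (k , k<m , refl) = reach-labelled path neighbour
      where
      neighbour : Labelled m ρ j
      neighbour with ℕP.anyUpTo? (λ l → ρ l Fin.≟ j) m
      ... | yes lab = lab
      ... | no  unl = case trans (sym adj) (cong isAdj (row-closed D (proj₂ (all-closed k<m)) j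
                                                         λ l l<m eq → unl (l , l<m , eq))) of λ ()

    label : Fin n → ℕ
    label j = proj₁ (reach-labelled (connected (ρ 0) j) (0 , nonempty , refl))

    label< : ∀ j → label j < m
    label< j = proj₁ (proj₂ (reach-labelled (connected (ρ 0) j) (0 , nonempty , refl)))

    ρ-label : ∀ j → ρ (label j) ≡ j
    ρ-label j = proj₂ (proj₂ (reach-labelled (connected (ρ 0) j) (0 , nonempty , refl)))

    label-ρ : ∀ {k} → k < m → label (ρ k) ≡ k
    label-ρ k<m = injective D (label< _) k<m (ρ-label _)

    iso : (c : Certificate rs) → Iso σ (cand (Certificate.target c))
    iso (certificate p forward backward valid) = mk↔ₛ′ to from to-from from-to , preserves
      where
      π  = forwardMap rs p forward backward
      π⁻ = backwardMap rs p forward backward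

      signs : T (preservesSigns rs p forward backward)
      signs = proj₁ (∧-elim valid)
      left : T (leftInverse rs p forward backward)
      left = proj₁ (∧-elim (proj₂ (∧-elim {preservesSigns rs p forward backward} valid)))
      right : T (rightInverse rs p forward backward)
      right = proj₂ (∧-elim (proj₂ (∧-elim {preservesSigns rs p forward backward} valid)))

      π⁻π : ∀ {k} → k < m → π⁻ (π k) ≡ k
      π⁻π k<m = ℕP.≡ᵇ⇒≡ _ _ (allBelow-sound m _ left k<m)

      ππ⁻ : ∀ t → π (π⁻ t) ≡ t
      ππ⁻ t = FinP.toℕ-injective (ℕP.≡ᵇ⇒≡ _ _ (proj₁ (∧-elim (allFinᵇ-sound _ right t))))

      π⁻< : ∀ t → π⁻ t < m
      π⁻< t = ℕP.<ᵇ⇒< _ _ (proj₂ (∧-elim {Fin.toℕ (π (π⁻ t)) ≡ᵇ Fin.toℕ t} (allFinᵇ-sound _ right t)))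

      to : Fin n → Fin (order p)
      to = π ∘ label
      from : Fin (order p) → Fin n
      from = ρ ∘ π⁻

      to-from : ∀ t → to (from t) ≡ t
      to-from t = trans (cong π (label-ρ (π⁻< t))) (ππ⁻ t)
      from-to : ∀ j → from (to j) ≡ j
      from-to j = trans (cong ρ (π⁻π (label< j))) (ρ-label j)

      preserves : ∀ i j → cand p (to i) (to j) ≡ σ i j
      preserves i j with all-closed (label< i)
      ... | r , ri = begin
        cand p (to i) (to j)
          ≡⟨ does-sound (_ ≟ˢ _) (allBelow-sound m _ (allBelow-sound m _ signs (label< i)) (label< j)) ⟩
        signAt (rowOf (rowAt rs (label i))) (label j)  ≡⟨ cong (λ q → signAt (rowOf q) (label j)) ri ⟩
        signAt r (label j)                             ≡⟨ row-signs D ri (label< j) ⟨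
        σ (ρ (label i)) (ρ (label j))                  ≡⟨ cong₂ σ (ρ-label i) (ρ-label j) ⟩
        σ i j                                          ∎
        where open ≡-Reasoning

  Goal : Set
  Goal = ∃[ p ] Iso σ (cand p)

  mutual
    search-sound : ∀ fuel {rs p ρ} → Describes rs ρ → Respects par p → 0 < length rs → search fuel rs p ≡ true → Goal
    search-sound (suc fuel) {rs} D resp nonempty ok with firstOpen rs in first
    ... | nothing =
      let c = fromJust _ (subst T (sym ok) tt) in
      Certificate.target c , Leaf.iso D nonempty (firstOpen-nothing rs first) c
    ... | just x with firstOpen-just rs first
    ...   | x<m , x-open =
      chooseRow-sound fuel D resp nonempty x<m x-open (initialRow-partial D x<m x-open) (subst T (sym ok) tt)

    chooseRow-sound : ∀ fuel {rs p ρ x us row} → Describes rs ρ → Respects par p → 0 < length rs →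
                      x < length rs → rowAt rs x ≡ nothing → PartialRow rs ρ x us row →
                      T (chooseRow fuel rs p x us row) → Goal
    chooseRow-sound fuel D resp nonempty x<m x-open R ok =
      branch-sound fuel D resp nonempty x<m x-open R
        (if-holds (early-passes D resp x<m x-open R) (if-resolve (not-overfull D R) ok))

    branch-sound : ∀ fuel {rs p ρ x us row} → Describes rs ρ → Respects par p → 0 < length rs →
                   x < length rs → rowAt rs x ≡ nothing → PartialRow rs ρ x us row →
                   T (branch fuel rs p x us row) → Goal
    branch-sound fuel {us = []} {row} D resp _ x<m x-open R ok =
      close-sound fuel {row = row} D resp x<m x-open (length-row R) (λ k<m → decided R k<m λ ()) ok
    branch-sound fuel {rs} {p} {ρ} {x} {u ∷ us} {row} D resp nonempty x<m x-open R ok with σ (ρ x) (ρ u) in sign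
    ... | non = chooseRow-sound fuel D resp nonempty x<m x-open (PartialRow-skip R sign)
                  (proj₁ (∧-elim ok))
    ... | pos = chooseRow-sound fuel D resp nonempty x<m x-open (PartialRow-set R sign)
                  (proj₁ (∧-elim (proj₂ (∧-elim {chooseRow fuel rs p x us row} ok))))
    ... | neg = chooseRow-sound fuel D resp nonempty x<m x-open (PartialRow-set R sign)
                  (proj₂ (∧-elim (proj₂ (∧-elim {chooseRow fuel rs p x us row} ok))))

    close-sound : ∀ fuel {rs p ρ x row} → Describes rs ρ → Respects par p → x < length rs → rowAt rs x ≡ nothing →
                  length row ≡ length rs → (∀ {k} → k < length rs → signAt row k ≡ σ (ρ x) (ρ k)) →
                  T (continue fuel (closeVertex rs x row) (finalCheck (closeVertex rs x row) 0 x (completeRow row) p)) → Goal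
    close-sound fuel {x = x} {row} D resp x<m x-open length-row row-true ok =
      search-sound fuel describes′ (proj₂ (proj₂ checked)) (ℕP.<-≤-trans (s≤s z≤n) (rowAt-bound rows′ rowAt-x))
        (Equivalence.to T-≡ (subst (T ∘ continue fuel rows′) (proj₁ (proj₂ checked)) ok))
      where
      open Closing D x<m x-open row length-row row-true
      checked = finalCheck-succeeds par rows′ 0 x R′ resp final-entries

  explore : Fin n → Goal
  explore v =
    search-sound 40 {nothing ∷ []} {noParams} {λ _ → v} start (noParams-respects par) (s≤s z≤n) exhaustive
    where
    start : Describes (nothing ∷ []) (λ _ → v)
    start = record
      { injective  = λ { (s≤s z≤n) (s≤s z≤n) _ → refl }
      ; row-signs  = λ { {zero} () ; {suc _} () }
      ; row-closed = λ { {zero} () ; {suc _} () }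
      ; row-length = λ { {zero} () ; {suc _} () }
      }

count-adjacent : ∀ {n} (f : Fin n → Sign) → count (isAdj ∘ f) ≡ count (isPos ∘ f) + count (isNeg ∘ f)
count-adjacent {zero}  f = refl
count-adjacent {suc n} f with f fzero | count-adjacent (f ∘ fsuc)
... | pos | eq = cong suc eq
... | neg | eq = trans (cong suc eq) (sym (ℕP.+-suc _ _))
... | non | eq = eq

net-regular-degrees : ∀ {p q} → p + q ≡ 5 → + p -ℤ + q ≡ + 3 → p ≡ 4 × q ≡ 1
net-regular-degrees {0} refl ()
net-regular-degrees {1} refl ()
net-regular-degrees {2} refl ()
net-regular-degrees {3} refl ()
net-regular-degrees {4} refl _ = refl , refl
net-regular-degrees {5} refl ()

srParam : ℤ → ℤ → ℤ → Sign → ℤ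
srParam a b c pos = a
srParam a b c neg = b
srParam a b c non = c

SRSGParams-sq : ∀ {n} {σ : Fin n → Fin n → Sign} {r a b c} → SRSGParams σ r a b c →
                ∀ i j → i ≢ j → sq σ i j ≡ srParam a b c (σ i j)
SRSGParams-sq {σ = σ} (_ , _ , _ , on-pos , on-neg , off) i j i≢j with σ i j in sign
... | pos = on-pos i j sign
... | neg = on-neg i j sign
... | non = off i j i≢j sign

classification : ∀ n (σ : Fin n → Fin n → Sign) → Good σ → ∃[ p ] Iso σ (cand p)
classification zero    σ (_ , _ , _ , _ , _ , _ , _ , _ , _ , not-edgeless , _) = ⊥-elim (not-edgeless λ ())
classification (suc n) σ (simple , connected , regular , net-regular , _ , a , b , c , srsg) =
  Exploration.explore σ simple connected (proj₁ ∘ degrees) (proj₂ ∘ degrees) (srParam a b c) (SRSGParams-sq srsg) fzero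
  where
  degrees : ∀ i → count (isPos ∘ σ i) ≡ 4 × count (isNeg ∘ σ i) ≡ 1
  degrees i = net-regular-degrees (trans (sym (count-adjacent (σ i))) (regular i)) (net-regular i)

module Decide {N : ℕ} (σ : Fin N → Fin N → Sign) where

  simple? : Dec (IsSimple σ)
  simple? = FinP.all? (λ i → FinP.all? λ j → σ i j ≟ˢ σ j i) ×-dec FinP.all? (λ i → σ i i ≟ˢ non)

  regular? : ∀ r → Dec (Regular σ r)
  regular? r = FinP.all? λ i → deg σ i ℕP.≟ r

  netRegular? : ∀ ρ → Dec (NetRegular σ ρ)
  netRegular? ρ = FinP.all? λ i → netdeg σ i ℤ.≟ ρ

  Adjacent : Fin N → Fin N → Set
  Adjacent i j = isAdj (σ i j) ≡ true

  WithinTwo : Fin N → Fin N → Set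
  WithinTwo i j = i ≡ j ⊎ Adjacent i j ⊎ ∃[ k ] Adjacent i k × Adjacent k j

  withinTwo? : ∀ i j → Dec (WithinTwo i j)
  withinTwo? i j = (i Fin.≟ j) ⊎-dec (isAdj (σ i j) Bool.≟ true)
                   ⊎-dec FinP.any? (λ k → (isAdj (σ i k) Bool.≟ true) ×-dec (isAdj (σ k j) Bool.≟ true))

  WithinTwo⇒Reach : ∀ {i j} → WithinTwo i j → Reach σ i j
  WithinTwo⇒Reach (inj₁ refl)                    = here
  WithinTwo⇒Reach (inj₂ (inj₁ adj))              = step adj here
  WithinTwo⇒Reach (inj₂ (inj₂ (k , adj₁ , adj₂))) = step adj₁ (step adj₂ here)

  diameterTwo? : Dec (∀ i j → WithinTwo i j)
  diameterTwo? = FinP.all? λ i → FinP.all? λ j → withinTwo? i j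

  diagonal? : ∀ r → Dec (∀ i → sq σ i i ≡ + r)
  diagonal? r = FinP.all? λ i → sq σ i i ℤ.≟ + r

  onEdges? : ∀ s v → Dec (∀ i j → σ i j ≡ s → sq σ i j ≡ v)
  onEdges? s v = FinP.all? λ i → FinP.all? λ j → (σ i j ≟ˢ s) →-dec (sq σ i j ℤ.≟ v)

  offEdges? : ∀ v → Dec (∀ i j → ¬ (i ≡ j) → σ i j ≡ non → sq σ i j ≡ v)
  offEdges? v = FinP.all? λ i → FinP.all? λ j → ¬? (i Fin.≟ j) →-dec ((σ i j ≟ˢ non) →-dec (sq σ i j ℤ.≟ v))

  Triangle : Sign → Sign → Sign → Set
  Triangle s t u = ∃[ i ] ∃[ j ] ∃[ k ] σ i j ≡ s × σ j k ≡ t × σ k i ≡ u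

  triangle? : ∀ s t u → Dec (Triangle s t u)
  triangle? s t u = FinP.any? λ i → FinP.any? λ j → FinP.any? λ k →
    (σ i j ≟ˢ s) ×-dec (σ j k ≟ˢ t) ×-dec (σ k i ≟ˢ u)

open Decide

edge⇒¬Edgeless : ∀ {N} {σ : Fin N → Fin N → Sign} i j {s} → σ i j ≡ s → s ≢ non → ¬ Edgeless σ
edge⇒¬Edgeless i j eq s≢non edgeless = s≢non (trans (sym eq) (edgeless i j))

mixed⇒¬Homogeneous : ∀ {N} {σ : Fin N → Fin N → Sign} {i j k l} → σ i j ≡ pos → σ k l ≡ neg →
                     ¬ (Homogeneous σ × Complete σ)
mixed⇒¬Homogeneous p n (inj₁ no-neg , _) = no-neg _ _ n
mixed⇒¬Homogeneous p n (inj₂ no-pos , _) = no-pos _ _ p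

gap⇒¬Complete : ∀ {N} {σ : Fin N → Fin N → Sign} i j → i ≢ j → σ i j ≡ non → ¬ (Homogeneous σ × Complete σ)
gap⇒¬Complete i j i≢j gap (_ , complete) = complete i j i≢j gap

srsg-by-computation : ∀ {N} (σ : Fin N → Fin N → Sign) {r a b c} →
  ¬ (Homogeneous σ × Complete σ) → ¬ Edgeless σ →
  True (diagonal? σ r) → True (onEdges? σ pos a) → True (onEdges? σ neg b) → True (offEdges? σ c) →
  SRSGParams σ r a b c
srsg-by-computation σ ¬hc ¬e d p n o = ¬hc , ¬e , toWitness d , toWitness p , toWitness n , toWitness o

good-by-computation : ∀ {N} (σ : Fin N → Fin N → Sign) {a b c} → SRSGParams σ 5 a b c →
  True (simple? σ) → True (diameterTwo? σ) → True (regular? σ 5) → True (netRegular? σ (+ 3)) → Good σ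
good-by-computation σ {a} {b} {c} srsg s d r n =
  toWitness s , (λ i j → WithinTwo⇒Reach σ (toWitness d i j)) , toWitness r , toWitness n , 5 , a , b , c , srsg

G1-srsg : SRSGParams G1 5 (+ 0) (+ 4) (+ 0)
G1-srsg = srsg-by-computation G1 (mixed⇒¬Homogeneous {i = # 0} {# 2} {# 0} {# 1} refl refl)
                                 (edge⇒¬Edgeless (# 0) (# 1) refl λ ()) _ _ _ _

S18-srsg : SRSGParams S18 5 (- (+ 2)) (+ 4) (+ 4)
S18-srsg = srsg-by-computation S18 (gap⇒¬Complete (# 0) (# 4) (λ ()) refl)
                                   (edge⇒¬Edgeless (# 0) (# 1) refl λ ()) _ _ _ _

S110-srsg : SRSGParams S110 5 (- (+ 2)) (+ 4) (+ 2)
S110-srsg = srsg-by-computation S110 (gap⇒¬Complete (# 0) (# 4) (λ ()) refl)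
                                   (edge⇒¬Edgeless (# 0) (# 1) refl λ ()) _ _ _ _

S210-srsg : SRSGParams S210 5 (+ 0) (+ 0) (+ 1)
S210-srsg = srsg-by-computation S210 (gap⇒¬Complete (# 0) (# 1) (λ ()) refl)
                                   (edge⇒¬Edgeless (# 0) (# 5) refl λ ()) _ _ _ _

S310-srsg : SRSGParams S310 5 (+ 3) (+ 0) (- (+ 2))
S310-srsg = srsg-by-computation S310 (gap⇒¬Complete (# 0) (# 6) (λ ()) refl)
                                   (edge⇒¬Edgeless (# 0) (# 1) refl λ ()) _ _ _ _

cand-good : ∀ p → Good (cand p)
cand-good fzero                             = good-by-computation G1 G1-srsg _ _ _ _
cand-good (fsuc fzero)                      = good-by-computation S18 S18-srsg _ _ _ _
cand-good (fsuc (fsuc fzero))               = good-by-computation S110 S110-srsg _ _ _ _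
cand-good (fsuc (fsuc (fsuc fzero)))        = good-by-computation S210 S210-srsg _ _ _ _
cand-good (fsuc (fsuc (fsuc (fsuc fzero)))) = good-by-computation S310 S310-srsg _ _ _ _

module _ {N M} {σ : Fin N → Fin N → Sign} {τ : Fin M → Fin M → Sign} (iso : Iso σ τ) where
  open Inverse (proj₁ iso)

  Iso-sym : Iso τ σ
  Iso-sym = ↔-sym (proj₁ iso) , λ a b →
    trans (sym (proj₂ iso (from a) (from b))) (cong₂ τ (strictlyInverseˡ a) (strictlyInverseˡ b))

  Iso-triangle : ∀ {s t u} → Triangle σ s t u → Triangle τ s t u
  Iso-triangle (i , j , k , ij , jk , ki) =
    to i , to j , to k , trans (proj₂ iso i j) ij , trans (proj₂ iso j k) jk , trans (proj₂ iso k i) ki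

fingerprint : ∀ {N} → (Fin N → Fin N → Sign) → ℕ × Bool × Bool
fingerprint {N} σ = N , does (triangle? σ pos pos pos) , does (triangle? σ neg pos pos)

Iso-fingerprint : ∀ {N M} {σ : Fin N → Fin N → Sign} {τ : Fin M → Fin M → Sign} →
                  Iso σ τ → fingerprint σ ≡ fingerprint τ
Iso-fingerprint {σ = σ} {τ} iso =
  cong₂ _,_ (↔⇒≡ (proj₁ iso)) (cong₂ _,_ (invariant pos pos pos) (invariant neg pos pos))
  where
  invariant : ∀ s t u → does (triangle? σ s t u) ≡ does (triangle? τ s t u)
  invariant s t u = does-⇔ (mk⇔ (Iso-triangle iso) (Iso-triangle (Iso-sym iso))) (triangle? σ s t u) (triangle? τ s t u)

fingerprint-injective : ∀ p q → fingerprint (cand p) ≡ fingerprint (cand q) → p ≡ q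
fingerprint-injective = toWitness {a? = FinP.all? λ p → FinP.all? λ q →
  ≡-dec ℕP._≟_ (≡-dec Bool._≟_ Bool._≟_) (fingerprint (cand p)) (fingerprint (cand q)) →-dec (p Fin.≟ q)} _

cand-distinct : ∀ p q → Iso (cand p) (cand q) → p ≡ q
cand-distinct p q = fingerprint-injective p q ∘ Iso-fingerprint

theorem3p3 : ((n : ℕ) (σ : Fin n → Fin n → Sign) → Good σ → ∃[ p ] Iso σ (cand p))
    × (∀ p → Good (cand p))
    × (∀ p q → Iso (cand p) (cand q) → p ≡ q)
    × SRSGParams G1 5 (+ 0) (+ 4) (+ 0)
    × SRSGParams S18 5 (- (+ 2)) (+ 4) (+ 4)
    × SRSGParams S110 5 (- (+ 2)) (+ 4) (+ 2)
    × SRSGParams S210 5 (+ 0) (+ 0) (+ 1)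
    × SRSGParams S310 5 (+ 3) (+ 0) (- (+ 2))
theorem3p3 = classification , cand-good , cand-distinct , G1-srsg , S18-srsg , S110-srsg , S210-srsg , S310-srsg
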